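{- Let $T$ be a maximal partial transversal of deficit $d$ in a Latin square $L$ of order $n \geq 3$. (1) If $d=0$, then $T$ is contained in exactly $n^2-n$ distinct $(n+1)$-covers of $L$, none of which is minimal. (2) If $d=1$, then $T$ is contained in exactly $3(n-1)$ distinct $(n+1)$-covers of $L$, each of which is minimal. (3) If $d=2$, then $T$ is contained in exactly $8$ distinct $(n+1)$-covers of $L$. (4) If $d\ge 3$, then $T$ is not contained in any $(n+1)$-cover of $L$.
   Context: A Latin square of order $n$ is an $n\times n$ array on $n$ symbols in which each symbol occurs once in each row and each column; its set of entries is $E(L)=\{(i,j,L_{ij})\}$. A line is the set of all entries in a given row, in a given column, or with a given symbol. A cover is a subset of $E(L)$ meeting every line; a $c$-cover is a cover of size $c$; a cover $\mathscr{C}$ is minimal if $\mathscr{C}\setminus\{\mathbf{e}\}$ is not a cover for every $\mathbf{e}\in\mathscr{C}$. A partial transversal of deficit $d$ is an $(n-d)$-subset of $E(L)$ in which every line is represented at most once; it is maximal if adding any further entry of $E(L)$ destroys this property. -}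

module Defs where

open import Data.Nat using (ℕ; zero; suc; _+_; _*_; _∸_; _≤_)
open import Data.Fin using (Fin)
open import Data.Bool using (Bool; true; false)
open import Data.Vec using (Vec; lookup; updateAt; map; foldr)
open import Data.Vec.Properties using (≡-dec)
open import Data.Fin.Subset using (Subset; ∣_∣)
open import Data.List using (List; length)
open import Data.List.Membership.Propositional using (_∈_)
open import Data.List.Relation.Unary.All using (All)
open import Data.List.Relation.Unary.Unique.Propositional using (Unique)
open import Data.Product using (Σ; ∃; _×_; _,_)
open import Relation.Binary.PropositionalEquality using (_≡_; _≢_)
open import Relation.Nullary using (¬_)

Square : ℕ → Set
Square n = Fin n → Fin n → Fin n

IsLatin : ∀ {n} → Square n → Set
IsLatin {n} L =
  (∀ (i s : Fin n) → ∃ λ j → L i j ≡ s) ×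
  (∀ (i j j' : Fin n) → L i j ≡ L i j' → j ≡ j') ×
  (∀ (j s : Fin n) → ∃ λ i → L i j ≡ s) ×
  (∀ (i i' j : Fin n) → L i j ≡ L i' j → i ≡ i')

-- An entry (i , j , L i j) of E(L) is determined by its cell (i , j), so a
-- subset of E(L) is represented canonically as an n×n Boolean matrix:
-- the entry in cell (i , j) belongs to S iff lookup (lookup S i) j ≡ true.
EntrySet : ℕ → Set
EntrySet n = Vec (Subset n) n

_∋_,_ : ∀ {n} → EntrySet n → Fin n → Fin n → Set
S ∋ i , j = lookup (lookup S i) j ≡ true

size : ∀ {n} → EntrySet n → ℕ
size S = foldr (λ _ → ℕ) _+_ 0 (map ∣_∣ S)

_⊆E_ : ∀ {n} → EntrySet n → EntrySet n → Set
_⊆E_ {n} S S' = ∀ (i j : Fin n) → S ∋ i , j → S' ∋ i , j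

addE : ∀ {n} → EntrySet n → Fin n → Fin n → EntrySet n
addE S i j = updateAt S i (λ row → updateAt row j (λ _ → true))

removeE : ∀ {n} → EntrySet n → Fin n → Fin n → EntrySet n
removeE S i j = updateAt S i (λ row → updateAt row j (λ _ → false))

AtMostOncePerLine : ∀ {n} → Square n → EntrySet n → Set
AtMostOncePerLine {n} L S =
  ∀ (i j i' j' : Fin n) → S ∋ i , j → S ∋ i' , j' →
    (i ≡ i' → j ≡ j') × (j ≡ j' → i ≡ i') ×
    (L i j ≡ L i' j' → (i ≡ i') × (j ≡ j'))

PartialTransversal : ∀ {n} → Square n → ℕ → EntrySet n → Set
PartialTransversal {n} L d T = AtMostOncePerLine L T × size T + d ≡ n

MaximalPartialTransversal : ∀ {n} → Square n → ℕ → EntrySet n → Set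
MaximalPartialTransversal {n} L d T =
  PartialTransversal L d T ×
  (∀ (i j : Fin n) → ¬ (T ∋ i , j) → ¬ AtMostOncePerLine L (addE T i j))

IsCover : ∀ {n} → Square n → EntrySet n → Set
IsCover {n} L C =
  (∀ (i : Fin n) → ∃ λ j → C ∋ i , j) ×
  (∀ (j : Fin n) → ∃ λ i → C ∋ i , j) ×
  (∀ (s : Fin n) → ∃ λ i → ∃ λ j → C ∋ i , j × L i j ≡ s)

IsCCover : ∀ {n} → Square n → ℕ → EntrySet n → Set
IsCCover L c C = IsCover L C × size C ≡ c

IsMinimalCover : ∀ {n} → Square n → EntrySet n → Set
IsMinimalCover {n} L C =
  IsCover L C × (∀ (i j : Fin n) → C ∋ i , j → ¬ IsCover L (removeE C i j))

CoverContaining : ∀ {n} → Square n → EntrySet n → EntrySet n → Set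
CoverContaining {n} L T C = T ⊆E C × IsCCover L (suc n) C

ExactlyMany : ∀ {n} → ℕ → (EntrySet n → Set) → Set
ExactlyMany {n} k P =
  Σ (List (EntrySet n)) λ xs →
    length xs ≡ k × Unique xs × All P xs × (∀ C → P C → C ∈ xs)

module Submission where

-- Let C be such a cover.  Its entries outside T (the extra entries) number
-- d + 1, and each of the d rows, d columns and d symbols that T misses is
-- met by one of them.  By maximality of T no cell lies on a missing row, a
-- missing column and a missing symbol at once, so an extra entry meets at
-- most two missing lines: 3d ≤ 2(d + 1), hence d ≤ 2 (part 4).
-- Conversely, T together with d + 1 new entries meeting every missing line
-- is such a cover, and a cover is determined by its extra entries.  The
-- covers are therefore counted by the ways of meeting the missing lines
-- with d + 1 entries: one arbitrary entry for d = 0, two entries in one of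
-- three shapes, n + (n - 1) + (n - 2) in all, for d = 1, and three entries
-- given by 8 binary choices for d = 2.  Minimality is read off the same
-- description.

open import Defs

open import Data.Nat using (ℕ; zero; suc; _+_; _*_; _∸_; _≤_; z≤n; s≤s; _≡ᵇ_)
open import Data.Nat.Properties
  using ( module ≤-Reasoning; <-irrefl; ≤-trans; ≤-refl; ≤-reflexive; ≤-antisym; suc-injective
        ; +-suc; +-identityʳ; +-comm; +-mono-≤; +-cancelˡ-≡; +-cancelˡ-≤; *-identityʳ; m+n∸m≡n
        ; +-0-commutativeMonoid )
open import Data.Fin using (Fin; zero; suc; _≟_)
import Data.Fin.Properties as Fin
open import Data.Bool using (Bool; true; false; _∧_; not)
open import Data.Bool.Properties using (∧-identityʳ; ∧-zeroʳ) renaming (_≟_ to _≟ᵇ_)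
open import Data.Product using (Σ; _×_; _,_; proj₁; proj₂)
open import Data.Sum using (_⊎_; inj₁; inj₂)
open import Data.Empty using (⊥; ⊥-elim)
open import Data.Vec using (Vec; []; _∷_; lookup; updateAt)
import Data.Vec as Vec
open import Data.Vec.Properties using (lookup∘updateAt; lookup∘updateAt′; tabulate∘lookup; tabulate-cong)
open import Data.Fin.Subset using (Subset; ∣_∣)
open import Data.Product.Properties using (≡-dec)
import Data.List.Relation.Unary.All.Properties as AllP
open AllP using (All¬⇒¬Any)
open import Data.List using (List; []; _∷_; _++_; length; map; filter; cartesianProduct; allFin)
open import Data.List.Properties using (length-map; length-++; length-tabulate)
open import Data.List.Membership.Propositional using (_∈_)
open import Data.List.Membership.Propositional.Properties
  using ( ∈-filter⁺; ∈-filter⁻; ∈-cartesianProduct⁺; ∈-allFin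
        ; ∈-map⁺; ∈-map⁻; ∈-++⁺ˡ; ∈-++⁺ʳ; ∈-++⁻ )
open import Data.List.Relation.Unary.Any using (here; there)
open import Data.List.Relation.Unary.All as All using (All; []; _∷_)
open import Data.List.Relation.Unary.AllPairs using ([]; _∷_)
open import Data.List.Relation.Unary.Unique.Propositional using (Unique)
import Data.List.Relation.Unary.Unique.Propositional.Properties as Unique
open import Function using (_∘_; _$_)
open import Data.Unit using (⊤; tt)
open import Data.Nat.Tactic.RingSolver using (solve-∀)
open import Relation.Binary.PropositionalEquality
open import Relation.Binary.Definitions using (DecidableEquality)
open import Relation.Nullary using (¬_; yes; no)
open import Relation.Nullary.Decidable using (⌊_⌋)
open import Algebra.Properties.CommutativeMonoid.Sum +-0-commutativeMonoid
  using (sum; sum-cong-≗; ∑-distrib-+; ∑-comm; sum-replicate-zero)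

⟦_⟧ : Bool → ℕ
⟦ true ⟧ = 1
⟦ false ⟧ = 0

⟦⟧≤1 : ∀ b → ⟦ b ⟧ ≤ 1
⟦⟧≤1 true = ≤-refl
⟦⟧≤1 false = z≤n

true≢false : true ≢ false
true≢false ()

¬true⇒false : ∀ {b} → ¬ (b ≡ true) → b ≡ false
¬true⇒false {false} _ = refl
¬true⇒false {true} ¬b = ⊥-elim (¬b refl)

-- A comes with decidable equality, a summation operator and a
-- duplicate-free list of all its elements; of the summation we only use
-- that it is a sum of its terms, through the effect of raising one term.
module Counting {A : Set} (_≟_ : DecidableEquality A)
  (∑ : (A → ℕ) → ℕ)
  (∑-cong : ∀ {f g : A → ℕ} → (∀ x → f x ≡ g x) → ∑ f ≡ ∑ g)
  (∑-zero : ∑ (λ _ → 0) ≡ 0)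
  (∑-bump : ∀ (f g : A → ℕ) a → (∀ x → x ≢ a → f x ≡ g x) → f a ≡ suc (g a) →
            ∑ f ≡ suc (∑ g))
  (elements : List A) (∈-elements : ∀ x → x ∈ elements) (elements-unique : Unique elements)
  where

  _==_ : A → A → Bool
  x == y = ⌊ x ≟ y ⌋

  ==-refl : ∀ x → (x == x) ≡ true
  ==-refl x with x ≟ x
  ... | yes _ = refl
  ... | no x≢x = ⊥-elim (x≢x refl)

  ==-sound : ∀ {x y} → (x == y) ≡ true → x ≡ y
  ==-sound {x} {y} h with x ≟ y
  ... | yes x≡y = x≡y

  ==-complete : ∀ {x y} → x ≢ y → (x == y) ≡ false
  ==-complete {x} {y} x≢y with x ≟ y
  ... | yes x≡y = ⊥-elim (x≢y x≡y)
  ... | no _ = refl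

  ≢⇒not== : ∀ {x y} → x ≢ y → not (x == y) ≡ true
  ≢⇒not== x≢y rewrite ==-complete x≢y = refl

  not==⇒≢ : ∀ {x y} → not (x == y) ≡ true → x ≢ y
  not==⇒≢ {x} h refl with () ← trans (sym h) (cong not (==-refl x))

  #_ : (A → Bool) → ℕ
  # q = ∑ (λ x → ⟦ q x ⟧)

  #-cong : ∀ {q r : A → Bool} → (∀ x → q x ≡ r x) → # q ≡ # r
  #-cong q≗r = ∑-cong (λ x → cong ⟦_⟧ (q≗r x))

  _∖_ : (A → Bool) → A → A → Bool
  (q ∖ a) x = q x ∧ not (x == a)

  ∖-keeps : ∀ q {a x} → q x ≡ true → x ≢ a → (q ∖ a) x ≡ true
  ∖-keeps q {a} {x} qx x≢a rewrite qx | ==-complete x≢a = refl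

  ∖-sound : ∀ q {a x} → (q ∖ a) x ≡ true → q x ≡ true × x ≢ a
  ∖-sound q {a} {x} h with q x | x == a in eq
  ... | true | false = refl , λ { refl → true≢false (trans (sym (==-refl x)) eq) }

  #-split : ∀ q a → # q ≡ ⟦ q a ⟧ + # (q ∖ a)
  #-split q a with q a in qa
  ... | true = ∑-bump _ _ a away at-a
    where
    away : ∀ x → x ≢ a → ⟦ q x ⟧ ≡ ⟦ (q ∖ a) x ⟧
    away x x≢a rewrite ==-complete x≢a with q x
    ... | true = refl
    ... | false = refl
    at-a : ⟦ q a ⟧ ≡ suc ⟦ (q ∖ a) a ⟧
    at-a rewrite qa | ==-refl a = refl
  ... | false = #-cong same
    where
    same : ∀ x → q x ≡ (q ∖ a) x
    same x with q x in qx | x == a in eq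
    ... | b | false = sym (∧-identityʳ b)
    ... | false | true = refl
    ... | true | true = trans (sym qx) (trans (cong q (==-sound eq)) qa)

  #-none : ∀ q → (∀ x → q x ≡ false) → # q ≡ 0
  #-none q none = trans (#-cong none) ∑-zero

  #-member : ∀ q {a} → q a ≡ true → 1 ≤ # q
  #-member q {a} qa rewrite #-split q a | qa = s≤s z≤n

  #-zero : ∀ q → # q ≡ 0 → ∀ x → q x ≡ false
  #-zero q empty x with q x in qx
  ... | false = refl
  ... | true with () ← ≤-trans (#-member q qx) (≤-reflexive empty)

  length≤# : ∀ q {xs} → Unique xs → All (λ x → q x ≡ true) xs → length xs ≤ # q
  length≤# q [] [] = z≤n
  length≤# q {x ∷ xs} (x∉xs ∷ u) (qx ∷ qxs) rewrite #-split q x | qx =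
    s≤s (length≤# (q ∖ x) u
      (All.zipWith (λ (qy , x≢y) → ∖-keeps q qy (λ y≡x → x≢y (sym y≡x))) (qxs , x∉xs)))

  #≤length : ∀ q xs → (∀ x → q x ≡ true → x ∈ xs) → # q ≤ length xs
  #≤length q [] complete = ≤-reflexive (#-none q none)
    where
    none : ∀ x → q x ≡ false
    none x with q x in qx
    ... | false = refl
    ... | true with () ← complete x qx
  #≤length q (y ∷ ys) complete rewrite #-split q y =
    +-mono-≤ (⟦⟧≤1 (q y)) (#≤length (q ∖ y) ys rest)
    where
    rest : ∀ x → (q ∖ y) x ≡ true → x ∈ ys
    rest x h with ∖-sound q h
    ... | qx , x≢y with complete x qx
    ...   | here x≡y = ⊥-elim (x≢y x≡y)
    ...   | there x∈ys = x∈ys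

  enumerate : (A → Bool) → List A
  enumerate q = filter (λ x → q x ≟ᵇ true) elements

  enumerate-unique : ∀ q → Unique (enumerate q)
  enumerate-unique q = Unique.filter⁺ (λ x → q x ≟ᵇ true) elements-unique

  ∈-enumerate⁺ : ∀ q {x} → q x ≡ true → x ∈ enumerate q
  ∈-enumerate⁺ q qx = ∈-filter⁺ (λ x → q x ≟ᵇ true) (∈-elements _) qx

  ∈-enumerate⁻ : ∀ q {x} → x ∈ enumerate q → q x ≡ true
  ∈-enumerate⁻ q x∈ = proj₂ (∈-filter⁻ (λ x → q x ≟ᵇ true) {xs = elements} x∈)

  enumerate-all : ∀ q → All (λ x → q x ≡ true) (enumerate q)
  enumerate-all q = All.tabulate (∈-enumerate⁻ q)

  length-enumerate : ∀ q → length (enumerate q) ≡ # q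
  length-enumerate q = ≤-antisym (length≤# q (enumerate-unique q) (enumerate-all q))
                                 (#≤length q (enumerate q) (λ _ → ∈-enumerate⁺ q))

  #-witness : ∀ q → 1 ≤ # q → Σ A λ a → q a ≡ true
  #-witness q pos with enumerate q | length-enumerate q | enumerate-all q
  ... | a ∷ _ | _ | qa ∷ _ = a , qa
  ... | [] | len | _ with () ← ≤-trans pos (≤-reflexive (sym len))

  #≡1 : ∀ q → # q ≡ 1 → Σ A λ a → q a ≡ true × (∀ x → q x ≡ true → x ≡ a)
  #≡1 q one with enumerate q | length-enumerate q | enumerate-all q | ∈-enumerate⁺ q
  ... | a ∷ [] | _ | qa ∷ [] | complete = a , qa , λ x qx → only (complete qx)
    where
    only : ∀ {x} → x ∈ a ∷ [] → x ≡ a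
    only (here x≡a) = x≡a
  ... | [] | len | _ | _ with () ← trans len one
  ... | _ ∷ _ ∷ _ | len | _ | _ with () ← trans len one

  #≡2 : ∀ q → # q ≡ 2 → Σ A λ a → Σ A λ b → a ≢ b × q a ≡ true × q b ≡ true ×
          (∀ x → q x ≡ true → x ≡ a ⊎ x ≡ b)
  #≡2 q two with enumerate q | length-enumerate q | enumerate-all q | ∈-enumerate⁺ q | enumerate-unique q
  ... | a ∷ b ∷ [] | _ | qa ∷ qb ∷ [] | complete | (a≢b ∷ []) ∷ _ =
    a , b , a≢b , qa , qb , λ x qx → one-of (complete qx)
    where
    one-of : ∀ {x} → x ∈ a ∷ b ∷ [] → x ≡ a ⊎ x ≡ b
    one-of (here x≡a) = inj₁ x≡a
    one-of (there (here x≡b)) = inj₂ x≡b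
  ... | [] | len | _ | _ | _ with () ← trans len two
  ... | _ ∷ [] | len | _ | _ | _ with () ← trans len two
  ... | _ ∷ _ ∷ _ ∷ _ | len | _ | _ | _ with () ← trans len two

sum-const : ∀ n c → sum {n} (λ _ → c) ≡ n * c
sum-const zero c = refl
sum-const (suc n) c = cong (c +_) (sum-const n c)

sum-mono : ∀ {n} {f g : Fin n → ℕ} → (∀ k → f k ≤ g k) → sum f ≤ sum g
sum-mono {zero} f≤g = z≤n
sum-mono {suc n} f≤g = +-mono-≤ (f≤g zero) (sum-mono (f≤g ∘ suc))

sum-bump : ∀ {n} (f g : Fin n → ℕ) a → (∀ k → k ≢ a → f k ≡ g k) → f a ≡ suc (g a) →
           sum f ≡ suc (sum g)
sum-bump {suc n} f g zero same fa rewrite fa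
  | sum-cong-≗ {x = f ∘ suc} {g ∘ suc} (λ k → same (suc k) λ ()) = refl
sum-bump {suc n} f g (suc a) same fa rewrite same zero (λ ())
  | sum-bump (f ∘ suc) (g ∘ suc) a (λ k k≢a → same (suc k) (λ e → k≢a (Fin.suc-injective e))) fa =
  +-suc (g zero) (sum (g ∘ suc))

module Fins {n : ℕ} = Counting {Fin n} _≟_ sum sum-cong-≗ (sum-replicate-zero n)
  sum-bump (allFin n) ∈-allFin (Unique.allFin⁺ n)

open Fins using () renaming (_==_ to _==ᶠ_; ==-refl to ==ᶠ-refl; ==-sound to ==ᶠ-sound)

Cell : ℕ → Set
Cell n = Fin n × Fin n

_≟ᶜ_ : ∀ {n} → DecidableEquality (Cell n)
_≟ᶜ_ = ≡-dec _≟_ _≟_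

Meets : ∀ {n} → (Cell n → Set) → (Cell n → Fin n) → (Fin n → Bool) → Set
Meets {n} P line M = ∀ k → M k ≡ true → Σ (Cell n) λ c → P c × line c ≡ k

Meets-mono : ∀ {n} {P Q : Cell n → Set} {line M} → (∀ {c} → P c → Q c) →
  Meets P line M → Meets Q line M
Meets-mono P⇒Q meets k Mk with meets k Mk
... | c , Pc , lc = c , P⇒Q Pc , lc

vacuous : ∀ {n} {P : Cell n → Set} {line M} → Fins.# M ≡ 0 → Meets P line M
vacuous none k Mk with () ← trans (sym Mk) (Fins.#-zero _ none k)

∑ᶜ : ∀ {n} → (Cell n → ℕ) → ℕ
∑ᶜ f = sum λ i → sum λ j → f (i , j)

∑ᶜ-cong : ∀ {n} {f g : Cell n → ℕ} → (∀ c → f c ≡ g c) → ∑ᶜ f ≡ ∑ᶜ g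
∑ᶜ-cong f≗g = sum-cong-≗ (λ i → sum-cong-≗ (λ j → f≗g (i , j)))

∑ᶜ-zero : ∀ n → ∑ᶜ {n} (λ _ → 0) ≡ 0
∑ᶜ-zero n = trans (sum-cong-≗ {n} (λ _ → sum-replicate-zero n)) (sum-replicate-zero n)

∑ᶜ-bump : ∀ {n} (f g : Cell n → ℕ) a → (∀ c → c ≢ a → f c ≡ g c) → f a ≡ suc (g a) →
          ∑ᶜ f ≡ suc (∑ᶜ g)
∑ᶜ-bump f g (a , b) same fab =
  sum-bump _ _ a (λ i i≢a → sum-cong-≗ (λ j → same (i , j) (λ e → i≢a (cong proj₁ e))))
    (sum-bump _ _ b (λ j j≢b → same (a , j) (λ e → j≢b (cong proj₂ e))) fab)

∑ᶜ-+ : ∀ {n} (f g : Cell n → ℕ) → ∑ᶜ (λ c → f c + g c) ≡ ∑ᶜ f + ∑ᶜ g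
∑ᶜ-+ f g = trans (sum-cong-≗ (λ i → ∑-distrib-+ (λ j → f (i , j)) (λ j → g (i , j))))
  (∑-distrib-+ (λ i → sum (λ j → f (i , j))) (λ i → sum (λ j → g (i , j))))

∑ᶜ-mono : ∀ {n} {f g : Cell n → ℕ} → (∀ c → f c ≤ g c) → ∑ᶜ f ≤ ∑ᶜ g
∑ᶜ-mono f≤g = sum-mono (λ i → sum-mono (λ j → f≤g (i , j)))

allCells : ∀ n → List (Cell n)
allCells n = cartesianProduct (allFin n) (allFin n)

module Cells {n : ℕ} = Counting {Cell n} _≟ᶜ_ ∑ᶜ ∑ᶜ-cong (∑ᶜ-zero n)
  ∑ᶜ-bump (allCells n) (λ c → ∈-cartesianProduct⁺ (∈-allFin _) (∈-allFin _))
  (Unique.cartesianProduct⁺ (Unique.allFin⁺ n) (Unique.allFin⁺ n))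

open Cells using (#_)

#-by-lines : ∀ {n} (line : Cell n → Fin n) (q : Cell n → Bool) →
  # q ≡ sum (λ k → # (λ c → q c ∧ (k ==ᶠ line c)))
#-by-lines line q = begin
    ∑ᶜ (λ c → ⟦ q c ⟧)
      ≡⟨ ∑ᶜ-cong (λ c → sym (on-one-line c)) ⟩
    sum (λ i → sum (λ j → sum (λ k → ⟦ q (i , j) ∧ (k ==ᶠ line (i , j)) ⟧)))
      ≡⟨ sum-cong-≗ (λ i → ∑-comm (λ j k → ⟦ q (i , j) ∧ (k ==ᶠ line (i , j)) ⟧)) ⟩
    sum (λ i → sum (λ k → sum (λ j → ⟦ q (i , j) ∧ (k ==ᶠ line (i , j)) ⟧)))
      ≡⟨ ∑-comm (λ i k → sum (λ j → ⟦ q (i , j) ∧ (k ==ᶠ line (i , j)) ⟧)) ⟩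
    sum (λ k → ∑ᶜ (λ c → ⟦ q c ∧ (k ==ᶠ line c) ⟧)) ∎
  where
  open ≡-Reasoning
  off : ∀ c k → ((λ k → q c ∧ (k ==ᶠ line c)) Fins.∖ line c) k ≡ false
  off c k with k ==ᶠ line c
  ... | true = ∧-zeroʳ (q c ∧ true)
  ... | false = cong (_∧ true) (∧-zeroʳ (q c))
  on-one-line : ∀ c → Fins.# (λ k → q c ∧ (k ==ᶠ line c)) ≡ ⟦ q c ⟧
  on-one-line c rewrite Fins.#-split (λ k → q c ∧ (k ==ᶠ line c)) (line c) | ==ᶠ-refl (line c)
    | Fins.#-none ((λ k → q c ∧ (k ==ᶠ line c)) Fins.∖ line c) (off c) =
    trans (+-identityʳ ⟦ q c ∧ true ⟧) (cong ⟦_⟧ (∧-identityʳ (q c)))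

member : ∀ {n} → EntrySet n → Cell n → Bool
member S c = lookup (lookup S (proj₁ c)) (proj₂ c)

size≡# : ∀ {n} (S : EntrySet n) → size S ≡ # (member S)
size≡# S = rows S
  where
  row : ∀ {n} (p : Subset n) → ∣ p ∣ ≡ sum (λ j → ⟦ lookup p j ⟧)
  row [] = refl
  row (true ∷ p) = cong suc (row p)
  row (false ∷ p) = row p
  rows : ∀ {m n} (S : Vec (Subset n) m) →
    Vec.foldr (λ _ → ℕ) _+_ 0 (Vec.map ∣_∣ S) ≡ sum (λ i → sum (λ j → ⟦ lookup (lookup S i) j ⟧))
  rows [] = refl
  rows (p ∷ S) = cong₂ _+_ (row p) (rows S)

member-ext : ∀ {n} {S S′ : EntrySet n} → (∀ c → member S c ≡ member S′ c) → S ≡ S′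
member-ext same = vec-ext (λ i → vec-ext (λ j → same (i , j)))
  where
  vec-ext : ∀ {A : Set} {m} {xs ys : Vec A m} → (∀ i → lookup xs i ≡ lookup ys i) → xs ≡ ys
  vec-ext {xs = xs} {ys} h =
    trans (sym (tabulate∘lookup xs)) (trans (tabulate-cong h) (tabulate∘lookup ys))

setCell : ∀ {n} → EntrySet n → Fin n → Fin n → Bool → EntrySet n
setCell S a b v = updateAt S a (λ row → updateAt row b (λ _ → v))

member-set-at : ∀ {n} (S : EntrySet n) a b v → member (setCell S a b v) (a , b) ≡ v
member-set-at S a b v rewrite lookup∘updateAt a {λ row → updateAt row b (λ _ → v)} S =
  lookup∘updateAt b (lookup S a)

member-set-off : ∀ {n} (S : EntrySet n) a b v c → c ≢ (a , b) →
  member (setCell S a b v) c ≡ member S c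
member-set-off S a b v (i , j) c≢ab with i ≟ a
... | no i≢a rewrite lookup∘updateAt′ i a {λ row → updateAt row b (λ _ → v)} i≢a S = refl
... | yes refl rewrite lookup∘updateAt i {λ row → updateAt row b (λ _ → v)} S =
  lookup∘updateAt′ j b (λ j≡b → c≢ab (cong (i ,_) j≡b)) (lookup S i)

addE-⁻ : ∀ {n} (S : EntrySet n) a b c → member (addE S a b) c ≡ true →
  member S c ≡ true ⊎ c ≡ (a , b)
addE-⁻ S a b c h with c ≟ᶜ (a , b)
... | yes c≡ab = inj₂ c≡ab
... | no c≢ab = inj₁ (trans (sym (member-set-off S a b true c c≢ab)) h)

addE-⁺ : ∀ {n} (S : EntrySet n) a b c → member S c ≡ true → member (addE S a b) c ≡ true
addE-⁺ S a b c h with c ≟ᶜ (a , b)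
... | yes refl = member-set-at S a b true
... | no c≢ab = trans (member-set-off S a b true c c≢ab) h

removeE-⁻ : ∀ {n} (S : EntrySet n) a b c → member (removeE S a b) c ≡ true →
  member S c ≡ true × c ≢ (a , b)
removeE-⁻ S a b c h with c ≟ᶜ (a , b)
... | yes refl with () ← trans (sym h) (member-set-at S a b false)
... | no c≢ab = trans (sym (member-set-off S a b false c c≢ab)) h , c≢ab

removeE-⁺ : ∀ {n} (S : EntrySet n) a b c → member S c ≡ true → c ≢ (a , b) →
  member (removeE S a b) c ≡ true
removeE-⁺ S a b c h c≢ab = trans (member-set-off S a b false c c≢ab) h

size-addE : ∀ {n} (S : EntrySet n) a b → member S (a , b) ≡ false →
  size (addE S a b) ≡ suc (size S)
size-addE S a b new = begin
    size (addE S a b)        ≡⟨ size≡# (addE S a b) ⟩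
    # (member (addE S a b))  ≡⟨ ∑ᶜ-bump _ _ (a , b) off at ⟩
    suc (# (member S))       ≡⟨ cong suc (sym (size≡# S)) ⟩
    suc (size S)             ∎
  where
  open ≡-Reasoning
  off : ∀ c → c ≢ (a , b) → ⟦ member (addE S a b) c ⟧ ≡ ⟦ member S c ⟧
  off c c≢ab = cong ⟦_⟧ (member-set-off S a b true c c≢ab)
  at : ⟦ member (addE S a b) (a , b) ⟧ ≡ suc ⟦ member S (a , b) ⟧
  at rewrite member-set-at S a b true | new = refl

_⊕_ : ∀ {n} → EntrySet n → List (Cell n) → EntrySet n
S ⊕ [] = S
S ⊕ (c ∷ cs) = addE (S ⊕ cs) (proj₁ c) (proj₂ c)

⊕-⁺ˡ : ∀ {n} (S : EntrySet n) cs c → member S c ≡ true → member (S ⊕ cs) c ≡ true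
⊕-⁺ˡ S [] c h = h
⊕-⁺ˡ S (c′ ∷ cs) c h = addE-⁺ (S ⊕ cs) _ _ c (⊕-⁺ˡ S cs c h)

⊕-⁺ʳ : ∀ {n} (S : EntrySet n) {cs c} → c ∈ cs → member (S ⊕ cs) c ≡ true
⊕-⁺ʳ S {c′ ∷ cs} (here refl) = member-set-at (S ⊕ cs) _ _ true
⊕-⁺ʳ S {c′ ∷ cs} (there c∈cs) = addE-⁺ (S ⊕ cs) _ _ _ (⊕-⁺ʳ S c∈cs)

⊕-⁻ : ∀ {n} (S : EntrySet n) cs c → member (S ⊕ cs) c ≡ true → member S c ≡ true ⊎ c ∈ cs
⊕-⁻ S [] c h = inj₁ h
⊕-⁻ S (c′ ∷ cs) c h with addE-⁻ (S ⊕ cs) _ _ c h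
... | inj₂ refl = inj₂ (here refl)
... | inj₁ h′ with ⊕-⁻ S cs c h′
...   | inj₁ inS = inj₁ inS
...   | inj₂ c∈cs = inj₂ (there c∈cs)

size-⊕ : ∀ {n} (S : EntrySet n) {cs} → Unique cs → All (λ c → member S c ≡ false) cs →
  size (S ⊕ cs) ≡ length cs + size S
size-⊕ S {[]} [] [] = refl
size-⊕ S {c ∷ cs} (c∉cs ∷ u) (new ∷ news) =
  trans (size-addE (S ⊕ cs) _ _ fresh) (cong suc (size-⊕ S u news))
  where
  fresh : member (S ⊕ cs) c ≡ false
  fresh with member (S ⊕ cs) c in h
  ... | false = refl
  ... | true with ⊕-⁻ S cs c h
  ...   | inj₁ old = trans (sym old) new
  ...   | inj₂ c∈cs = ⊥-elim (All¬⇒¬Any c∉cs c∈cs)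

-- An entry set containing S and no larger than S is S: a member of S′
-- outside S, together with the members of S, would be too many.
⊆-size⇒≡ : ∀ {n} {S S′ : EntrySet n} → (∀ c → member S c ≡ true → member S′ c ≡ true) →
  size S′ ≤ size S → S ≡ S′
⊆-size⇒≡ {S = S} {S′} S⊆S′ small = member-ext same
  where
  no-extra : ∀ c → member S c ≡ false → member S′ c ≡ true → ⊥
  no-extra c outS inS′ = <-irrefl refl $ begin-strict
      # (member S)                          ≡⟨ sym (Cells.length-enumerate (member S)) ⟩
      length (Cells.enumerate (member S))   <⟨ Cells.length≤# (member S′) unique members ⟩
      # (member S′)                         ≡⟨ sym (size≡# S′) ⟩
      size S′                               ≤⟨ small ⟩
      size S                                ≡⟨ size≡# S ⟩
      # (member S)                          ∎
    where
    open ≤-Reasoning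
    unique : Unique (c ∷ Cells.enumerate (member S))
    unique = All.tabulate (λ { y∈ refl → true≢false (trans (sym (Cells.∈-enumerate⁻ (member S) y∈)) outS) })
             ∷ Cells.enumerate-unique (member S)
    members : All (λ x → member S′ x ≡ true) (c ∷ Cells.enumerate (member S))
    members = inS′ ∷ All.map (S⊆S′ _) (Cells.enumerate-all (member S))
  same : ∀ c → member S c ≡ member S′ c
  same c with member S c in inS | member S′ c in inS′
  ... | true | true = refl
  ... | true | false = trans (sym (S⊆S′ c inS)) inS′
  ... | false | false = refl
  ... | false | true = ⊥-elim (no-extra c inS inS′)

meets-lines : ∀ {n} (line : Cell n → Fin n) (M : Fin n → Bool) (S : Cell n → Bool) →
  Meets (λ c → S c ≡ true) line M → Fins.# M ≤ # (λ c → S c ∧ M (line c))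
meets-lines line M S meets = begin
    sum (λ k → ⟦ M k ⟧)                                          ≤⟨ sum-mono bound ⟩
    sum (λ k → # (λ c → (S c ∧ M (line c)) ∧ (k ==ᶠ line c)))   ≡⟨ sym (#-by-lines line _) ⟩
    # (λ c → S c ∧ M (line c))                                   ∎
  where
  open ≤-Reasoning
  bound : ∀ k → ⟦ M k ⟧ ≤ # (λ c → (S c ∧ M (line c)) ∧ (k ==ᶠ line c))
  bound k with M k in Mk
  ... | false = z≤n
  ... | true with meets k Mk
  ...   | c , Sc , refl = Cells.#-member _ {c} counted
    where
    counted : ((S c ∧ M (line c)) ∧ (line c ==ᶠ line c)) ≡ true
    counted rewrite Sc | Mk | ==ᶠ-refl (line c) = refl

-- The lines of one family (the rows, the columns or the symbols of an
-- n×n array; line c is the line through cell c) and a set t of cells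
-- meeting every line at most once.
module Lines {n : ℕ} (line : Cell n → Fin n) (t : Cell n → Bool)
  (once : ∀ {c c′} → t c ≡ true → t c′ ≡ true → line c ≡ line c′ → c ≡ c′) where

  on : Fin n → Cell n → Bool
  on k c = t c ∧ (k ==ᶠ line c)

  on-sound : ∀ {k c} → on k c ≡ true → t c ≡ true × line c ≡ k
  on-sound {k} {c} h with t c | k ==ᶠ line c in eq
  ... | true | true = refl , sym (==ᶠ-sound eq)

  load-01 : ∀ k → # (on k) ≡ 0 ⊎ # (on k) ≡ 1
  load-01 k with Cells.enumerate (on k) | Cells.length-enumerate (on k)
               | Cells.enumerate-all (on k) | Cells.enumerate-unique (on k)
  ... | [] | len | _ | _ = inj₁ (sym len)
  ... | _ ∷ [] | len | _ | _ = inj₂ (sym len)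
  ... | c ∷ c′ ∷ _ | _ | oc ∷ oc′ ∷ _ | (c≢c′ ∷ _) ∷ _
    with on-sound oc | on-sound oc′
  ...   | tc , lc | tc′ , lc′ = ⊥-elim (c≢c′ (once tc tc′ (trans lc (sym lc′))))

  missing : Fin n → Bool
  missing k = # (on k) ≡ᵇ 0

  on-line : ∀ {c} → t c ≡ true → on (line c) c ≡ true
  on-line {c} tc rewrite tc | ==ᶠ-refl (line c) = refl

  missing⇒empty : ∀ {k c} → missing k ≡ true → t c ≡ true → line c ≢ k
  missing⇒empty {k} {c} mk tc refl with load-01 k
  ... | inj₂ one with () ← subst (λ m → (m ≡ᵇ 0) ≡ true) one mk
  ... | inj₁ none with () ← trans (sym (Cells.#-zero (on k) none c)) (on-line tc)

  present⇒met : ∀ {k} → missing k ≡ false → Σ (Cell n) λ c → t c ≡ true × line c ≡ k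
  present⇒met {k} mk with load-01 k
  ... | inj₁ none with () ← subst (λ m → (m ≡ᵇ 0) ≡ false) none mk
  ... | inj₂ one with Cells.#-witness (on k) (≤-reflexive (sym one))
  ...   | c , oc = c , on-sound oc

  #t+#missing : # t + Fins.# missing ≡ n
  #t+#missing = begin
      # t + Fins.# missing
        ≡⟨ cong (_+ Fins.# missing) (#-by-lines line t) ⟩
      sum (λ k → # (on k)) + sum (λ k → ⟦ missing k ⟧)
        ≡⟨ sym (∑-distrib-+ (λ k → # (on k)) (λ k → ⟦ missing k ⟧)) ⟩
      sum (λ k → # (on k) + ⟦ missing k ⟧)
        ≡⟨ sum-cong-≗ one-each ⟩
      sum {n} (λ _ → 1)
        ≡⟨ trans (sum-const n 1) (*-identityʳ n) ⟩
      n ∎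
    where
    open ≡-Reasoning
    one-each : ∀ k → # (on k) + ⟦ missing k ⟧ ≡ 1
    one-each k with load-01 k
    ... | inj₁ none rewrite none = refl
    ... | inj₂ one rewrite one = refl

  meets-all : (S : Cell n → Bool) → (∀ c → t c ≡ true → S c ≡ true) →
    Meets (λ c → S c ≡ true) line missing → ∀ k → Σ (Cell n) λ c → S c ≡ true × line c ≡ k
  meets-all S t⊆S meets k with missing k in mk
  ... | true = meets k mk
  ... | false with present⇒met mk
  ...   | c , tc , lc = c , t⊆S c tc , lc

-- An extra cell lying on two missing lines of three families is not on
-- a missing line of the third, so it counts at most twice.
at-most-two : ∀ e a b s → (a ≡ true → b ≡ true → s ≡ false) →
  ⟦ e ∧ a ⟧ + (⟦ e ∧ b ⟧ + ⟦ e ∧ s ⟧) ≤ ⟦ e ⟧ + ⟦ e ⟧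
at-most-two false a b s _ = z≤n
at-most-two true true true s third rewrite third refl refl = ≤-refl
at-most-two true true false s _ = s≤s (⟦⟧≤1 s)
at-most-two true false b s _ = +-mono-≤ (⟦⟧≤1 b) (⟦⟧≤1 s)

distinct₂ : ∀ {A : Set} {a b : A} → a ≢ b → Unique (a ∷ b ∷ [])
distinct₂ a≢b = (a≢b ∷ []) ∷ [] ∷ []

distinct₃ : ∀ {A : Set} {a b c : A} → a ≢ b → a ≢ c → b ≢ c → Unique (a ∷ b ∷ c ∷ [])
distinct₃ a≢b a≢c b≢c = (a≢b ∷ a≢c ∷ []) ∷ distinct₂ b≢c

distinct₄ : ∀ {A : Set} {a b c e : A} → a ≢ b → a ≢ c → a ≢ e → b ≢ c → b ≢ e → c ≢ e →
  Unique (a ∷ b ∷ c ∷ e ∷ [])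
distinct₄ a≢b a≢c a≢e b≢c b≢e c≢e = (a≢b ∷ a≢c ∷ a≢e ∷ []) ∷ distinct₃ b≢c b≢e c≢e

counted-by : ∀ {n} {I : Set} {P : EntrySet n → Set} (F : I → EntrySet n) (is : List I) →
  Unique is → (∀ {i j} → i ∈ is → j ∈ is → F i ≡ F j → i ≡ j) →
  (∀ {i} → i ∈ is → P (F i)) → (∀ C → P C → Σ I λ i → i ∈ is × C ≡ F i) →
  ExactlyMany (length is) P
counted-by {P = P} F is u injective valid complete =
  map F is , length-map F is , unique-map u injective , All.tabulate valid-image , complete-image
  where
  valid-image : ∀ {C} → C ∈ map F is → P C
  valid-image C∈ with ∈-map⁻ F C∈
  ... | i , i∈ , refl = valid i∈
  complete-image : ∀ C → P C → C ∈ map F is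
  complete-image C PC with complete C PC
  ... | i , i∈ , refl = ∈-map⁺ F i∈
  unique-map : ∀ {xs} → Unique xs → (∀ {i j} → i ∈ xs → j ∈ xs → F i ≡ F j → i ≡ j) →
    Unique (map F xs)
  unique-map [] _ = []
  unique-map {x ∷ xs} (x∉xs ∷ u) inj =
    AllP.map⁺ (All.tabulate (λ y∈ Fx≡Fy → All.lookup x∉xs y∈ (inj (here refl) (there y∈) Fx≡Fy)))
    ∷ unique-map u (λ i∈ j∈ → inj (there i∈) (there j∈))

module Transversal {n : ℕ} (L : Square n) (latin : IsLatin L) (d : ℕ) (T : EntrySet n)
  (maximal : MaximalPartialTransversal L d T) where

  t : Cell n → Bool
  t = member T

  symbol : Cell n → Fin n
  symbol c = L (proj₁ c) (proj₂ c)

  columnOf : Fin n → Fin n → Fin n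
  columnOf i s = proj₁ (proj₁ latin i s)

  columnOf-spec : ∀ i s → L i (columnOf i s) ≡ s
  columnOf-spec i s = proj₂ (proj₁ latin i s)

  rowOf : Fin n → Fin n → Fin n
  rowOf j s = proj₁ (proj₁ (proj₂ (proj₂ latin)) j s)

  rowOf-spec : ∀ j s → L (rowOf j s) j ≡ s
  rowOf-spec j s = proj₂ (proj₁ (proj₂ (proj₂ latin)) j s)

  row-injective : ∀ i {j j′} → L i j ≡ L i j′ → j ≡ j′
  row-injective i = proj₁ (proj₂ latin) i _ _

  column-injective : ∀ j {i i′} → L i j ≡ L i′ j → i ≡ i′
  column-injective j = proj₂ (proj₂ (proj₂ latin)) _ _ j

  amo : AtMostOncePerLine L T
  amo = proj₁ (proj₁ maximal)

  row-once : ∀ {c c′} → t c ≡ true → t c′ ≡ true → proj₁ c ≡ proj₁ c′ → c ≡ c′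
  row-once {i , j} {i′ , j′} tc tc′ refl = cong (i ,_) (proj₁ (amo i j i′ j′ tc tc′) refl)

  column-once : ∀ {c c′} → t c ≡ true → t c′ ≡ true → proj₂ c ≡ proj₂ c′ → c ≡ c′
  column-once {i , j} {i′ , j′} tc tc′ refl = cong (_, j) (proj₁ (proj₂ (amo i j i′ j′ tc tc′)) refl)

  symbol-once : ∀ {c c′} → t c ≡ true → t c′ ≡ true → symbol c ≡ symbol c′ → c ≡ c′
  symbol-once {i , j} {i′ , j′} tc tc′ e with proj₂ (proj₂ (amo i j i′ j′ tc tc′)) e
  ... | refl , refl = refl

  module Rows = Lines proj₁ t row-once
  module Cols = Lines proj₂ t column-once
  module Syms = Lines symbol t symbol-once

  #T : # t + d ≡ n
  #T = trans (cong (_+ d) (sym (size≡# T))) (proj₂ (proj₁ maximal))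

  #missing : ∀ {m} → # t + m ≡ n → m ≡ d
  #missing h = +-cancelˡ-≡ (# t) _ _ (trans h (sym #T))

  #missing-rows : Fins.# Rows.missing ≡ d
  #missing-rows = #missing Rows.#t+#missing

  #missing-columns : Fins.# Cols.missing ≡ d
  #missing-columns = #missing Cols.#t+#missing

  #missing-symbols : Fins.# Syms.missing ≡ d
  #missing-symbols = #missing Syms.#t+#missing

  -- Maximality: no cell lies on a missing row, a missing column and a
  -- missing symbol, since its entry could be added to T.
  no-free-cell : ∀ c → Rows.missing (proj₁ c) ≡ true → Cols.missing (proj₂ c) ≡ true →
    Syms.missing (symbol c) ≡ false
  no-free-cell (i , j) mr mc with Syms.missing (L i j) in ms
  ... | false = refl
  ... | true = ⊥-elim (proj₂ maximal i j (λ tij → Rows.missing⇒empty mr tij refl) still-once)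
    where
    apart : ∀ {c} → t c ≡ true → proj₁ c ≢ i × proj₂ c ≢ j × symbol c ≢ L i j
    apart tc = Rows.missing⇒empty mr tc , Cols.missing⇒empty mc tc , Syms.missing⇒empty ms tc
    still-once : AtMostOncePerLine L (addE T i j)
    still-once x y x′ y′ h h′ with addE-⁻ T i j (x , y) h | addE-⁻ T i j (x′ , y′) h′
    ... | inj₁ tx | inj₁ tx′ = amo x y x′ y′ tx tx′
    ... | inj₂ refl | inj₂ refl = (λ _ → refl) , (λ _ → refl) , (λ _ → refl , refl)
    ... | inj₂ refl | inj₁ tx′ with apart tx′
    ...   | r , c , s =
      (λ e → ⊥-elim (r (sym e))) , (λ e → ⊥-elim (c (sym e))) , (λ e → ⊥-elim (s (sym e)))
    still-once x y x′ y′ h h′ | inj₁ tx | inj₂ refl with apart tx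
    ...   | r , c , s = (λ e → ⊥-elim (r e)) , (λ e → ⊥-elim (c e)) , (λ e → ⊥-elim (s e))

  added-elsewhere : ∀ cs cs′ {x} → T ⊕ cs ≡ T ⊕ cs′ → x ∈ cs → t x ≡ false → x ∈ cs′
  added-elsewhere cs cs′ {x} same x∈cs tx
    with ⊕-⁻ T cs′ x (subst (λ S → member S x ≡ true) same (⊕-⁺ʳ T x∈cs))
  ... | inj₁ tx′ with () ← trans (sym tx′) tx
  ... | inj₂ x∈cs′ = x∈cs′

  off-row : ∀ {x} → Rows.missing (proj₁ x) ≡ true → t x ≡ false
  off-row m = ¬true⇒false (λ tx → Rows.missing⇒empty m tx refl)

  off-column : ∀ {x} → Cols.missing (proj₂ x) ≡ true → t x ≡ false
  off-column m = ¬true⇒false (λ tx → Cols.missing⇒empty m tx refl)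

  off-symbol : ∀ {x} → Syms.missing (symbol x) ≡ true → t x ≡ false
  off-symbol m = ¬true⇒false (λ tx → Syms.missing⇒empty m tx refl)

  free-cell-absurd : ∀ x → Rows.missing (proj₁ x) ≡ true → Cols.missing (proj₂ x) ≡ true →
    Syms.missing (symbol x) ≡ true → ⊥
  free-cell-absurd x mr mc ms with () ← trans (sym ms) (no-free-cell x mr mc)

  cover-criterion : (S : EntrySet n) → (∀ c → t c ≡ true → member S c ≡ true) →
    Meets (λ c → member S c ≡ true) proj₁ Rows.missing →
    Meets (λ c → member S c ≡ true) proj₂ Cols.missing →
    Meets (λ c → member S c ≡ true) symbol Syms.missing → IsCover L S
  cover-criterion S T⊆S mr mc ms = rows , columns , symbols
    where
    rows : ∀ i → Σ (Fin n) λ j → S ∋ i , j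
    rows i with Rows.meets-all (member S) T⊆S mr i
    ... | (_ , j) , h , refl = j , h
    columns : ∀ j → Σ (Fin n) λ i → S ∋ i , j
    columns j with Cols.meets-all (member S) T⊆S mc j
    ... | (i , _) , h , refl = i , h
    symbols : ∀ s → Σ (Fin n) λ i → Σ (Fin n) λ j → S ∋ i , j × L i j ≡ s
    symbols s with Syms.meets-all (member S) T⊆S ms s
    ... | (i , j) , h , e = i , j , h , e

  size-extension : ∀ {cs} → Unique cs → All (λ c → t c ≡ false) cs → length cs ≡ suc d →
    size (T ⊕ cs) ≡ suc n
  size-extension {cs} u new len = begin
      size (T ⊕ cs)         ≡⟨ size-⊕ T u new ⟩
      length cs + size T    ≡⟨ cong (_+ size T) len ⟩
      suc (d + size T)      ≡⟨ cong suc (+-comm d (size T)) ⟩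
      suc (size T + d)      ≡⟨ cong suc (proj₂ (proj₁ maximal)) ⟩
      suc n                 ∎
    where open ≡-Reasoning

  extension-cover : ∀ cs → Unique cs → All (λ c → t c ≡ false) cs → length cs ≡ suc d →
    Meets (_∈ cs) proj₁ Rows.missing → Meets (_∈ cs) proj₂ Cols.missing →
    Meets (_∈ cs) symbol Syms.missing → CoverContaining L T (T ⊕ cs)
  extension-cover cs u new len mr mc ms =
    (λ i j → ⊕-⁺ˡ T cs (i , j)) ,
    cover-criterion (T ⊕ cs) (⊕-⁺ˡ T cs) (Meets-mono (⊕-⁺ʳ T) mr) (Meets-mono (⊕-⁺ʳ T) mc)
      (Meets-mono (⊕-⁺ʳ T) ms) ,
    size-extension u new len

  module Extra (Cv : EntrySet n) (cover : CoverContaining L T Cv) where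
    open import Data.List.Membership.DecPropositional (_≟ᶜ_ {n}) using (_∈?_)

    T⊆Cv : ∀ c → t c ≡ true → member Cv c ≡ true
    T⊆Cv (i , j) = proj₁ cover i j

    extra : Cell n → Bool
    extra c = member Cv c ∧ not (t c)

    extra-intro : ∀ {c} → member Cv c ≡ true → t c ≡ false → extra c ≡ true
    extra-intro {c} h tc rewrite h | tc = refl

    extra-sound : ∀ {c} → extra c ≡ true → member Cv c ≡ true × t c ≡ false
    extra-sound {c} h with member Cv c | t c
    ... | true | false = refl , refl

    #extra : # extra ≡ suc d
    #extra = +-cancelˡ-≡ (# t) _ _ (begin
        # t + # extra                            ≡⟨ sym (∑ᶜ-+ (⟦_⟧ ∘ t) (⟦_⟧ ∘ extra)) ⟩
        ∑ᶜ (λ c → ⟦ t c ⟧ + ⟦ extra c ⟧)         ≡⟨ ∑ᶜ-cong split ⟩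
        # (member Cv)                            ≡⟨ sym (size≡# Cv) ⟩
        size Cv                                  ≡⟨ proj₂ (proj₂ cover) ⟩
        suc n                                    ≡⟨ cong suc (sym #T) ⟩
        suc (# t + d)                            ≡⟨ sym (+-suc (# t) d) ⟩
        # t + suc d                              ∎)
      where
      open ≡-Reasoning
      split : ∀ c → ⟦ t c ⟧ + ⟦ extra c ⟧ ≡ ⟦ member Cv c ⟧
      split c with t c in tc
      ... | true rewrite T⊆Cv c tc = refl
      ... | false rewrite ∧-identityʳ (member Cv c) = refl

    off-T : ∀ {line M} → (∀ {k c} → M k ≡ true → t c ≡ true → line c ≢ k) →
      Meets (λ c → member Cv c ≡ true) line M → Meets (λ c → extra c ≡ true) line M
    off-T {line} {M} empty meets k Mk with meets k Mk
    ... | c , h , lc = c , extra-intro h (¬true⇒false (λ tc → empty Mk tc lc)) , lc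

    extra-rows : Meets (λ c → extra c ≡ true) proj₁ Rows.missing
    extra-rows = off-T Rows.missing⇒empty λ i _ →
      let (j , h) = proj₁ (proj₁ (proj₂ cover)) i in (i , j) , h , refl

    extra-columns : Meets (λ c → extra c ≡ true) proj₂ Cols.missing
    extra-columns = off-T Cols.missing⇒empty λ j _ →
      let (i , h) = proj₁ (proj₂ (proj₁ (proj₂ cover))) j in (i , j) , h , refl

    extra-symbols : Meets (λ c → extra c ≡ true) symbol Syms.missing
    extra-symbols = off-T Syms.missing⇒empty λ s _ →
      let (i , j , h , e) = proj₂ (proj₂ (proj₁ (proj₂ cover))) s in (i , j) , h , e

    an-extra : Σ (Cell n) λ c → extra c ≡ true
    an-extra = Cells.#-witness extra (subst (1 ≤_) (sym #extra) (s≤s z≤n))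

    extra-bound : ∀ {cs} → Unique cs → All (λ c → extra c ≡ true) cs → length cs ≤ suc d
    extra-bound u all = ≤-trans (Cells.length≤# extra u all) (≤-reflexive #extra)

    extras-exhaust : ∀ cs → Unique cs → All (λ c → extra c ≡ true) cs → length cs ≡ suc d →
      ∀ {w} → extra w ≡ true → w ∈ cs
    extras-exhaust cs u all len {w} ew with w ∈? cs
    ... | yes w∈cs = w∈cs
    ... | no w∉cs = ⊥-elim (<-irrefl refl (subst (λ m → suc m ≤ suc d) len
          (extra-bound (All.tabulate (λ { y∈ refl → w∉cs y∈ }) ∷ u) (ew ∷ all))))

    Cv≡T⊕ : ∀ cs → Unique cs → All (λ c → extra c ≡ true) cs → length cs ≡ suc d → Cv ≡ T ⊕ cs
    Cv≡T⊕ cs u all len = sym (⊆-size⇒≡ inside (≤-reflexive (trans (proj₂ (proj₂ cover))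
      (sym (size-extension u (All.map (proj₂ ∘ extra-sound) all) len)))))
      where
      inside : ∀ c → member (T ⊕ cs) c ≡ true → member Cv c ≡ true
      inside c h with ⊕-⁻ T cs c h
      ... | inj₁ tc = T⊆Cv c tc
      ... | inj₂ c∈cs = proj₁ (extra-sound (All.lookup all c∈cs))

    -- The 3d missing lines each need an extra entry, and an extra entry
    -- lies on at most two of them: 3d ≤ 2(d + 1).
    d≤2 : d ≤ 2
    d≤2 = +-cancelˡ-≤ (d + d) d 2 (begin
        d + d + d
          ≡⟨ +-comm (d + d) d ⟩
        d + (d + d)
          ≤⟨ +-mono-≤ (lower #missing-rows extra-rows)
               (+-mono-≤ (lower #missing-columns extra-columns) (lower #missing-symbols extra-symbols)) ⟩
        # onRows + (# onCols + # onSyms)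
          ≡⟨ cong (# onRows +_) (sym (∑ᶜ-+ (⟦_⟧ ∘ onCols) (⟦_⟧ ∘ onSyms))) ⟩
        # onRows + ∑ᶜ (λ c → ⟦ onCols c ⟧ + ⟦ onSyms c ⟧)
          ≡⟨ sym (∑ᶜ-+ (⟦_⟧ ∘ onRows) (λ c → ⟦ onCols c ⟧ + ⟦ onSyms c ⟧)) ⟩
        ∑ᶜ (λ c → ⟦ onRows c ⟧ + (⟦ onCols c ⟧ + ⟦ onSyms c ⟧))
          ≤⟨ ∑ᶜ-mono (λ c → at-most-two (extra c) _ _ _ (no-free-cell c)) ⟩
        ∑ᶜ (λ c → ⟦ extra c ⟧ + ⟦ extra c ⟧)
          ≡⟨ ∑ᶜ-+ (⟦_⟧ ∘ extra) (⟦_⟧ ∘ extra) ⟩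
        # extra + # extra
          ≡⟨ cong₂ _+_ #extra #extra ⟩
        suc d + suc d
          ≡⟨ cong suc (+-suc d d) ⟩
        2 + (d + d)
          ≡⟨ +-comm 2 (d + d) ⟩
        d + d + 2 ∎)
      where
      open ≤-Reasoning
      onRows onCols onSyms : Cell n → Bool
      onRows c = extra c ∧ Rows.missing (proj₁ c)
      onCols c = extra c ∧ Cols.missing (proj₂ c)
      onSyms c = extra c ∧ Syms.missing (symbol c)
      lower : ∀ {line M} → Fins.# M ≡ d → Meets (λ c → extra c ≡ true) line M →
        d ≤ # (λ c → extra c ∧ M (line c))
      lower {line} {M} count meets =
        subst (_≤ # (λ c → extra c ∧ M (line c))) count (meets-lines line M extra meets)

  -- Deficit 0: T is a transversal, hence a cover, and the (n+1)-covers
  -- containing it are T plus one further entry.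
  module Deficit0 (d≡0 : d ≡ 0) where

    no-missing-rows : ∀ {P} → Meets P proj₁ Rows.missing
    no-missing-rows = vacuous (trans #missing-rows d≡0)

    no-missing-columns : ∀ {P} → Meets P proj₂ Cols.missing
    no-missing-columns = vacuous (trans #missing-columns d≡0)

    no-missing-symbols : ∀ {P} → Meets P symbol Syms.missing
    no-missing-symbols = vacuous (trans #missing-symbols d≡0)

    outside : List (Cell n)
    outside = Cells.enumerate (not ∘ t)

    outside-new : ∀ {c} → c ∈ outside → t c ≡ false
    outside-new {c} c∈ with t c | Cells.∈-enumerate⁻ (not ∘ t) c∈
    ... | false | _ = refl

    plus : Cell n → EntrySet n
    plus c = T ⊕ (c ∷ [])

    #outside : length outside ≡ n * n ∸ n
    #outside = begin
        length outside               ≡⟨ Cells.length-enumerate (not ∘ t) ⟩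
        # (not ∘ t)                  ≡⟨ sym (m+n∸m≡n (# t) (# (not ∘ t))) ⟩
        # t + # (not ∘ t) ∸ # t      ≡⟨ cong₂ _∸_ all-cells #t≡n ⟩
        n * n ∸ n                    ∎
      where
      open ≡-Reasoning
      #t≡n : # t ≡ n
      #t≡n = trans (sym (+-identityʳ (# t))) (trans (cong (# t +_) (sym d≡0)) #T)
      all-cells : # t + # (not ∘ t) ≡ n * n
      all-cells = begin
          # t + # (not ∘ t)                   ≡⟨ sym (∑ᶜ-+ (⟦_⟧ ∘ t) (⟦_⟧ ∘ not ∘ t)) ⟩
          ∑ᶜ (λ c → ⟦ t c ⟧ + ⟦ not (t c) ⟧)  ≡⟨ ∑ᶜ-cong (λ c → one (t c)) ⟩
          sum {n} (λ _ → sum {n} (λ _ → 1))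
            ≡⟨ sum-cong-≗ {n} (λ _ → trans (sum-const n 1) (*-identityʳ n)) ⟩
          sum {n} (λ _ → n)                   ≡⟨ sum-const n n ⟩
          n * n                               ∎
        where
        one : ∀ b → ⟦ b ⟧ + ⟦ not b ⟧ ≡ 1
        one true = refl
        one false = refl

    valid : ∀ {c} → c ∈ outside → CoverContaining L T (plus c)
    valid c∈ = extension-cover (_ ∷ []) ([] ∷ []) (outside-new c∈ ∷ []) (cong suc (sym d≡0))
      no-missing-rows no-missing-columns no-missing-symbols

    plus-injective : ∀ {c c′} → c ∈ outside → c′ ∈ outside → plus c ≡ plus c′ → c ≡ c′
    plus-injective {c} {c′} c∈ _ same
      with added-elsewhere (c ∷ []) (c′ ∷ []) same (here refl) (outside-new c∈)
    ... | here c≡c′ = c≡c′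

    complete : ∀ C → CoverContaining L T C → Σ (Cell n) λ c → c ∈ outside × C ≡ plus c
    complete C cover with Extra.an-extra C cover
    ... | c , ec = c , Cells.∈-enumerate⁺ (not ∘ t) (cong not (proj₂ (extra-sound ec))) ,
                   Cv≡T⊕ (c ∷ []) ([] ∷ []) (ec ∷ []) (cong suc (sym d≡0))
      where open Extra C cover

    -- The extra entry can be removed, leaving a superset of T.
    not-minimal : ∀ C → CoverContaining L T C → ¬ IsMinimalCover L C
    not-minimal C cover (_ , minimal) with Extra.an-extra C cover
    ... | (i , j) , ec = minimal i j (proj₁ (extra-sound ec))
          (cover-criterion (removeE C i j) T⊆C-c no-missing-rows no-missing-columns no-missing-symbols)
      where
      open Extra C cover
      T⊆C-c : ∀ c → t c ≡ true → member (removeE C i j) c ≡ true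
      T⊆C-c c tc = removeE-⁺ C i j c (T⊆Cv c tc)
        λ { refl → true≢false (trans (sym tc) (proj₂ (extra-sound ec))) }

  unique-via : ∀ {M : Fin n → Bool} {a line cs x} → (∀ k → M k ≡ true → k ≡ a) →
    x ∈ cs → line x ≡ a → Meets (_∈ cs) line M
  unique-via only x∈ lx k Mk = _ , x∈ , trans lx (sym (only k Mk))

  TheOnly : (Fin n → Bool) → Set
  TheOnly M = Σ (Fin n) λ a → M a ≡ true × (∀ k → M k ≡ true → k ≡ a)

  -- Deficit 1: T misses one row r, one column c and one symbol s, and
  -- L r c ≠ s by maximality.  An (n+1)-cover containing T adds two
  -- entries meeting r, c and s, in one of three shapes.
  module Deficit1 (d≡1 : d ≡ 1)
    (the-row : TheOnly Rows.missing) (the-column : TheOnly Cols.missing)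
    (the-symbol : TheOnly Syms.missing) where

    r c s : Fin n
    r = proj₁ the-row
    c = proj₁ the-column
    s = proj₁ the-symbol

    r-missing : Rows.missing r ≡ true
    r-missing = proj₁ (proj₂ the-row)

    c-missing : Cols.missing c ≡ true
    c-missing = proj₁ (proj₂ the-column)

    s-missing : Syms.missing s ≡ true
    s-missing = proj₁ (proj₂ the-symbol)

    only-r : ∀ k → Rows.missing k ≡ true → k ≡ r
    only-r = proj₂ (proj₂ the-row)

    only-c : ∀ k → Cols.missing k ≡ true → k ≡ c
    only-c = proj₂ (proj₂ the-column)

    only-s : ∀ k → Syms.missing k ≡ true → k ≡ s
    only-s = proj₂ (proj₂ the-symbol)

    s-cell : ∀ {x} → symbol x ≡ s → Syms.missing (symbol x) ≡ true
    s-cell {x} e = subst (λ k → Syms.missing k ≡ true) (sym e) s-missing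

    Lrc≢s : L r c ≢ s
    Lrc≢s e = free-cell-absurd (r , c) r-missing c-missing (s-cell e)

    c′ r″ : Fin n
    c′ = columnOf r s
    r″ = rowOf c s

    c′≢c : c′ ≢ c
    c′≢c e = Lrc≢s (subst (λ j → L r j ≡ s) e (columnOf-spec r s))

    r″≢r : r″ ≢ r
    r″≢r e = Lrc≢s (subst (λ i → L i c ≡ s) e (rowOf-spec c s))

    data Shape : Set where
      corner : Fin n → Shape
      row-s : Fin n → Shape
      column-s : Fin n → Shape

    admissible : Shape → Set
    admissible (corner i) = ⊤
    admissible (row-s i) = i ≢ r
    admissible (column-s j) = j ≢ c × j ≢ c′

    cells : Shape → List (Cell n)
    cells (corner i) = (r , c) ∷ (i , columnOf i s) ∷ []
    cells (row-s i) = (r , c′) ∷ (i , c) ∷ []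
    cells (column-s j) = (r″ , c) ∷ (r , j) ∷ []

    completion : Shape → EntrySet n
    completion σ = T ⊕ cells σ

    #cells : ∀ σ → length (cells σ) ≡ suc d
    #cells (corner _) = cong suc (sym d≡1)
    #cells (row-s _) = cong suc (sym d≡1)
    #cells (column-s _) = cong suc (sym d≡1)

    cells-unique : ∀ σ → admissible σ → Unique (cells σ)
    cells-unique (corner i) _ = distinct₂ (λ e → Lrc≢s (trans (cong symbol e) (columnOf-spec i s)))
    cells-unique (row-s i) i≢r = distinct₂ (λ e → i≢r (sym (cong proj₁ e)))
    cells-unique (column-s j) _ = distinct₂ (λ e → r″≢r (cong proj₁ e))

    valid : ∀ σ → admissible σ → CoverContaining L T (completion σ)
    valid σ ok = extension-cover (cells σ) (cells-unique σ ok) (new σ) (#cells σ)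
      (meets-r σ) (meets-c σ) (meets-s σ)
      where
      new : ∀ σ → All (λ x → t x ≡ false) (cells σ)
      new (corner i) = off-row r-missing ∷ off-symbol (s-cell (columnOf-spec i s)) ∷ []
      new (row-s i) = off-row r-missing ∷ off-column c-missing ∷ []
      new (column-s j) = off-column c-missing ∷ off-row r-missing ∷ []
      meets-r : ∀ σ → Meets (_∈ cells σ) proj₁ Rows.missing
      meets-r (corner i) = unique-via only-r (here refl) refl
      meets-r (row-s i) = unique-via only-r (here refl) refl
      meets-r (column-s j) = unique-via only-r (there (here refl)) refl
      meets-c : ∀ σ → Meets (_∈ cells σ) proj₂ Cols.missing
      meets-c (corner i) = unique-via only-c (here refl) refl
      meets-c (row-s i) = unique-via only-c (there (here refl)) refl
      meets-c (column-s j) = unique-via only-c (here refl) refl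
      meets-s : ∀ σ → Meets (_∈ cells σ) symbol Syms.missing
      meets-s (corner i) = unique-via only-s (there (here refl)) (columnOf-spec i s)
      meets-s (row-s i) = unique-via only-s (here refl) (columnOf-spec r s)
      meets-s (column-s j) = unique-via only-s (here refl) (rowOf-spec c s)

    -- The admissible shapes: n of the first kind, n - 1 of the second and
    -- n - 2 of the third.
    not-r not-c,c′ : Fin n → Bool
    not-r i = not (i ==ᶠ r)
    not-c,c′ j = not (j ==ᶠ c) ∧ not (j ==ᶠ c′)

    others-than-r : List (Fin n)
    others-than-r = Fins.enumerate not-r

    others-than-c,c′ : List (Fin n)
    others-than-c,c′ = Fins.enumerate not-c,c′

    shapes : List Shape
    shapes = map corner (allFin n) ++ map row-s others-than-r ++ map column-s others-than-c,c′

    ∈-shapes⁻ : ∀ {σ} → σ ∈ shapes → admissible σ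
    ∈-shapes⁻ σ∈ with ∈-++⁻ (map corner (allFin n)) σ∈
    ... | inj₁ σ∈₁ with ∈-map⁻ corner σ∈₁
    ...   | _ , _ , refl = tt
    ∈-shapes⁻ σ∈ | inj₂ σ∈₂ with ∈-++⁻ (map row-s others-than-r) σ∈₂
    ...   | inj₁ σ∈₃ with ∈-map⁻ row-s σ∈₃
    ...     | i , i∈ , refl = Fins.not==⇒≢ (Fins.∈-enumerate⁻ not-r i∈)
    ∈-shapes⁻ σ∈ | inj₂ σ∈₂ | inj₂ σ∈₃ with ∈-map⁻ column-s σ∈₃
    ...     | j , j∈ , refl with Fins.∈-enumerate⁻ not-c,c′ j∈
    ...       | h with not (j ==ᶠ c) in j≢c
    ...         | true = Fins.not==⇒≢ j≢c , Fins.not==⇒≢ h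

    ∈-shapes⁺ : ∀ σ → admissible σ → σ ∈ shapes
    ∈-shapes⁺ (corner i) _ = ∈-++⁺ˡ (∈-map⁺ corner (∈-allFin i))
    ∈-shapes⁺ (row-s i) i≢r =
      ∈-++⁺ʳ (map corner (allFin n))
        (∈-++⁺ˡ (∈-map⁺ row-s (Fins.∈-enumerate⁺ not-r (Fins.≢⇒not== i≢r))))
    ∈-shapes⁺ (column-s j) (j≢c , j≢c′) =
      ∈-++⁺ʳ (map corner (allFin n)) (∈-++⁺ʳ (map row-s others-than-r)
        (∈-map⁺ column-s (Fins.∈-enumerate⁺ not-c,c′ both)))
      where
      both : not-c,c′ j ≡ true
      both rewrite Fins.≢⇒not== j≢c = Fins.≢⇒not== j≢c′

    shapes-unique : Unique shapes
    shapes-unique =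
      Unique.++⁺ (Unique.map⁺ (λ { refl → refl }) (Unique.allFin⁺ n))
        (Unique.++⁺ (Unique.map⁺ (λ { refl → refl }) (Fins.enumerate-unique not-r))
                    (Unique.map⁺ (λ { refl → refl }) (Fins.enumerate-unique not-c,c′)) second-third)
        first-rest
      where
      second-third : ∀ {σ} → ¬ (σ ∈ map row-s others-than-r × σ ∈ map column-s others-than-c,c′)
      second-third (σ∈₂ , σ∈₃) with ∈-map⁻ row-s σ∈₂ | ∈-map⁻ column-s σ∈₃
      ... | _ , _ , refl | _ , _ , ()
      first-rest : ∀ {σ} →
        ¬ (σ ∈ map corner (allFin n) × σ ∈ map row-s others-than-r ++ map column-s others-than-c,c′)
      first-rest (σ∈₁ , σ∈) with ∈-map⁻ corner σ∈₁ | ∈-++⁻ (map row-s others-than-r) σ∈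
      ... | _ , _ , refl | inj₁ σ∈₂ with ∈-map⁻ row-s σ∈₂
      ...   | _ , _ , ()
      first-rest (σ∈₁ , σ∈) | _ , _ , refl | inj₂ σ∈₃ with ∈-map⁻ column-s σ∈₃
      ...   | _ , _ , ()

    #shapes : length shapes ≡ 3 * (n ∸ 1)
    #shapes = begin
        length shapes
          ≡⟨ length-++ (map corner (allFin n)) ⟩
        length (map corner (allFin n)) + length (map row-s others-than-r ++ map column-s others-than-c,c′)
          ≡⟨ cong₂ _+_ (trans (length-map corner (allFin n)) (length-tabulate {n = n} (λ i → i)))
                       (trans (length-++ (map row-s others-than-r))
                              (cong₂ _+_ (trans (length-map row-s others-than-r) (Fins.length-enumerate not-r))
                                         (trans (length-map column-s others-than-c,c′) (Fins.length-enumerate not-c,c′)))) ⟩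
        n + (Fins.# not-r + m)
          ≡⟨ cong₂ (λ a b → a + (b + m)) n≡ (trans (suc-injective (trans (sym (all-but r)) (all-but c))) #≢c) ⟩
        suc (suc m) + (suc m + m)
          ≡⟨ three-terms m ⟩
        3 * suc m
          ≡⟨ cong (λ k → 3 * (k ∸ 1)) (sym n≡) ⟩
        3 * (n ∸ 1) ∎
      where
      open ≡-Reasoning
      three-terms : ∀ m → suc (suc m) + (suc m + m) ≡ 3 * suc m
      three-terms = solve-∀
      m : ℕ
      m = Fins.# not-c,c′
      all-but : ∀ a → n ≡ suc (Fins.# (λ i → not (i ==ᶠ a)))
      all-but a = trans (sym (trans (sum-const n 1) (*-identityʳ n))) (Fins.#-split (λ _ → true) a)
      #≢c : Fins.# (λ j → not (j ==ᶠ c)) ≡ suc m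
      #≢c rewrite Fins.#-split (λ j → not (j ==ᶠ c)) c′ | Fins.≢⇒not== c′≢c = refl
      n≡ : n ≡ suc (suc m)
      n≡ = trans (all-but c) (cong suc #≢c)

    -- Distinct admissible shapes give distinct covers: (r , c) is added
    -- only by shapes of the first kind and (r , c′) not by the third,
    -- while within a kind the second cell determines the parameter.
    completion-injective : ∀ σ τ → admissible σ → admissible τ → completion σ ≡ completion τ → σ ≡ τ
    completion-injective (corner i) (corner i′) _ _ same
      with added-elsewhere (cells (corner i)) (cells (corner i′)) same (there (here refl))
             (off-symbol (s-cell (columnOf-spec i s)))
    ... | here e = ⊥-elim (Lrc≢s (trans (sym (cong symbol e)) (columnOf-spec i s)))
    ... | there (here e) = cong corner (cong proj₁ e)
    completion-injective (corner i) (row-s i′) _ i′≢r same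
      with added-elsewhere (cells (corner i)) (cells (row-s i′)) same (here refl) (off-row r-missing)
    ... | here e = ⊥-elim (c′≢c (sym (cong proj₂ e)))
    ... | there (here e) = ⊥-elim (i′≢r (sym (cong proj₁ e)))
    completion-injective (corner i) (column-s j) _ (j≢c , _) same
      with added-elsewhere (cells (corner i)) (cells (column-s j)) same (here refl) (off-row r-missing)
    ... | here e = ⊥-elim (r″≢r (sym (cong proj₁ e)))
    ... | there (here e) = ⊥-elim (j≢c (sym (cong proj₂ e)))
    completion-injective (row-s i) (row-s i′) _ _ same
      with added-elsewhere (cells (row-s i)) (cells (row-s i′)) same (there (here refl)) (off-column c-missing)
    ... | here e = ⊥-elim (c′≢c (sym (cong proj₂ e)))
    ... | there (here e) = cong row-s (cong proj₁ e)
    completion-injective (row-s i) (column-s j) _ (_ , j≢c′) same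
      with added-elsewhere (cells (row-s i)) (cells (column-s j)) same (here refl) (off-row r-missing)
    ... | here e = ⊥-elim (c′≢c (cong proj₂ e))
    ... | there (here e) = ⊥-elim (j≢c′ (sym (cong proj₂ e)))
    completion-injective (column-s j) (column-s j′) _ _ same
      with added-elsewhere (cells (column-s j)) (cells (column-s j′)) same (there (here refl)) (off-row r-missing)
    ... | here e = ⊥-elim (r″≢r (sym (cong proj₁ e)))
    ... | there (here e) = cong column-s (cong proj₂ e)
    completion-injective (row-s i) (corner i′) ok ok′ same =
      sym (completion-injective (corner i′) (row-s i) ok′ ok (sym same))
    completion-injective (column-s j) (corner i) ok ok′ same =
      sym (completion-injective (corner i) (column-s j) ok′ ok (sym same))
    completion-injective (column-s j) (row-s i) ok ok′ same =
      sym (completion-injective (row-s i) (column-s j) ok′ ok (sym same))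

    -- The shape of an (n+1)-cover containing T: if (r , c) is an extra
    -- entry, the other one is an s-entry; otherwise r and c are met by two
    -- extra entries, one of which is an s-entry.
    module ShapeOf (C : EntrySet n) (cover : CoverContaining L T C) where
      open Extra C cover

      through-corner : extra (r , c) ≡ true →
        Σ Shape λ σ → admissible σ × All (λ x → extra x ≡ true) (cells σ)
      through-corner erc with extra-symbols s s-missing
      ... | (i , j) , e , Lij≡s = corner i , tt , erc ∷ subst (λ j → extra (i , j) ≡ true) j≡ e ∷ []
        where
        j≡ : j ≡ columnOf i s
        j≡ = row-injective i (trans Lij≡s (sym (columnOf-spec i s)))

      through-row-and-column : ∀ jx iy → extra (r , jx) ≡ true → extra (iy , c) ≡ true →
        jx ≢ c → iy ≢ r → Σ Shape λ σ → admissible σ × All (λ x → extra x ≡ true) (cells σ)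
      through-row-and-column jx iy ex ey jx≢c iy≢r with jx ≟ c′
      ... | yes refl = row-s iy , iy≢r , ex ∷ ey ∷ []
      ... | no jx≢c′ with extra-symbols s s-missing
      ...   | w , ew , Lw≡s
        with extras-exhaust ((r , jx) ∷ (iy , c) ∷ []) (distinct₂ (λ e → iy≢r (sym (cong proj₁ e))))
               (ex ∷ ey ∷ []) (cong suc (sym d≡1)) ew
      ...     | here refl = ⊥-elim (jx≢c′ (row-injective r (trans Lw≡s (sym (columnOf-spec r s)))))
      ...     | there (here refl) =
        column-s jx , (jx≢c , jx≢c′) , subst (λ i → extra (i , c) ≡ true) iy≡ ey ∷ ex ∷ []
        where
        iy≡ : iy ≡ r″
        iy≡ = column-injective c (trans Lw≡s (sym (rowOf-spec c s)))

      shape : Σ Shape λ σ → admissible σ × All (λ x → extra x ≡ true) (cells σ)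
      shape with extra (r , c) in erc
      ... | true = through-corner erc
      ... | false with extra-rows r r-missing | extra-columns c c-missing
      ...   | (_ , jx) , ex , refl | (iy , _) , ey , refl =
        through-row-and-column jx iy ex ey (λ { refl → true≢false (trans (sym ex) erc) })
                                           (λ { refl → true≢false (trans (sym ey) erc) })

    complete : ∀ C → CoverContaining L T C → Σ Shape λ σ → σ ∈ shapes × C ≡ completion σ
    complete C cover with ShapeOf.shape C cover
    ... | σ , ok , extras =
      σ , ∈-shapes⁺ σ ok , Extra.Cv≡T⊕ C cover (cells σ) (cells-unique σ ok) extras (#cells σ)

    -- Removing an extra entry x leaves one
    -- extra entry, which would have to meet r, c and s at once; removing
    -- an entry x of T leaves its row, its column and its symbol to three
    -- distinct extra entries, one too many.
    minimal : ∀ C → CoverContaining L T C → IsMinimalCover L C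
    minimal C cover = proj₁ (proj₂ cover) , irreducible
      where
      open Extra C cover

      no-three-extras : ∀ {a b e} → extra a ≡ true → extra b ≡ true → extra e ≡ true →
        a ≢ b → a ≢ e → b ≢ e → ⊥
      no-three-extras ea eb ee a≢b a≢e b≢e =
        <-irrefl refl (subst (3 ≤_) (cong suc d≡1)
          (extra-bound (distinct₃ a≢b a≢e b≢e) (ea ∷ eb ∷ ee ∷ [])))

      irreducible : ∀ i j → C ∋ i , j → ¬ IsCover L (removeE C i j)
      irreducible i j inC (rows , columns , symbols) with t (i , j) in tx
      ... | false with rows r | columns c | symbols s
      ...   | y , hu | x′ , hv | a , b , hw , Lw≡s
        with removeE-⁻ C i j (r , y) hu | removeE-⁻ C i j (x′ , c) hv | removeE-⁻ C i j (a , b) hw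
      ...     | inC-u , u≢x | inC-v , v≢x | inC-w , w≢x
        with (r , y) ≟ᶜ (x′ , c) | (r , y) ≟ᶜ (a , b)
      ...       | no u≢v | _ = no-three-extras ex eu ev (≢-sym u≢x) (≢-sym v≢x) u≢v
        where
        ex = extra-intro inC tx
        eu = extra-intro inC-u (off-row r-missing)
        ev = extra-intro inC-v (off-column c-missing)
      ...       | yes _ | no u≢w = no-three-extras ex eu ew (≢-sym u≢x) (≢-sym w≢x) u≢w
        where
        ex = extra-intro inC tx
        eu = extra-intro inC-u (off-row r-missing)
        ew = extra-intro inC-w (off-symbol (s-cell Lw≡s))
      ...       | yes refl | yes refl = free-cell-absurd (r , c) r-missing c-missing (s-cell Lw≡s)
      irreducible i j inC (rows , columns , symbols) | true with rows i | columns j | symbols (L i j)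
      ...   | y , hu | x′ , hv | a , b , hw , Lw≡Lij
        with removeE-⁻ C i j (i , y) hu | removeE-⁻ C i j (x′ , j) hv | removeE-⁻ C i j (a , b) hw
      ...     | inC-u , u≢x | inC-v , v≢x | inC-w , w≢x =
        no-three-extras eu ev ew
          (λ e → u≢x (cong (i ,_) (cong proj₂ e)))
          (λ e → u≢x (cong (i ,_) (row-injective i (trans (cong symbol e) Lw≡Lij))))
          (λ e → v≢x (cong (_, j) (column-injective j (trans (cong symbol e) Lw≡Lij))))
        where
        -- T has no entry besides (i , j) in row i, column j or symbol L i j
        eu = extra-intro inC-u (¬true⇒false (λ tu → u≢x (row-once tu tx refl)))
        ev = extra-intro inC-v (¬true⇒false (λ tv → v≢x (column-once tv tx refl)))
        ew = extra-intro inC-w (¬true⇒false (λ tw → w≢x (symbol-once tw tx Lw≡Lij)))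

  TheTwo : (Fin n → Bool) → Set
  TheTwo M = Σ (Bool → Fin n) λ f →
    (∀ x → M (f x) ≡ true) × (∀ {x y} → f x ≡ f y → x ≡ y) ×
    (∀ k → M k ≡ true → Σ Bool λ x → k ≡ f x)

  -- Deficit 2: T misses rows ρ true, ρ false, columns κ true, κ false
  -- and symbols ς true, ς false.  An (n+1)-cover containing T adds three
  -- entries: (ρ a , κ b) on a missing row and column, the ς k-entry of
  -- the other missing row and the ς (not k)-entry of the other missing
  -- column, for one of the 8 choices of a, b, k.
  module Deficit2 (d≡2 : d ≡ 2) (the-rows : TheTwo Rows.missing)
    (the-columns : TheTwo Cols.missing) (the-symbols : TheTwo Syms.missing) where

    ρ κ ς : Bool → Fin n
    ρ = proj₁ the-rows
    κ = proj₁ the-columns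
    ς = proj₁ the-symbols

    ρ-missing : ∀ x → Rows.missing (ρ x) ≡ true
    ρ-missing = proj₁ (proj₂ the-rows)

    κ-missing : ∀ x → Cols.missing (κ x) ≡ true
    κ-missing = proj₁ (proj₂ the-columns)

    ς-missing : ∀ x → Syms.missing (ς x) ≡ true
    ς-missing = proj₁ (proj₂ the-symbols)

    ρ-injective : ∀ {x y} → ρ x ≡ ρ y → x ≡ y
    ρ-injective = proj₁ (proj₂ (proj₂ the-rows))

    κ-injective : ∀ {x y} → κ x ≡ κ y → x ≡ y
    κ-injective = proj₁ (proj₂ (proj₂ the-columns))

    ς-injective : ∀ {x y} → ς x ≡ ς y → x ≡ y
    ς-injective = proj₁ (proj₂ (proj₂ the-symbols))

    ρ-onto : ∀ k → Rows.missing k ≡ true → Σ Bool λ x → k ≡ ρ x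
    ρ-onto = proj₂ (proj₂ (proj₂ the-rows))

    κ-onto : ∀ k → Cols.missing k ≡ true → Σ Bool λ x → k ≡ κ x
    κ-onto = proj₂ (proj₂ (proj₂ the-columns))

    ς-onto : ∀ k → Syms.missing k ≡ true → Σ Bool λ x → k ≡ ς x
    ς-onto = proj₂ (proj₂ (proj₂ the-symbols))

    flip≢ : ∀ {f : Bool → Fin n} → (∀ {x y} → f x ≡ f y → x ≡ y) → ∀ x → f (not x) ≢ f x
    flip≢ injective true e with () ← injective e
    flip≢ injective false e with () ← injective e

    same-or-flip : ∀ a x → x ≡ a ⊎ x ≡ not a
    same-or-flip true true = inj₁ refl
    same-or-flip true false = inj₂ refl
    same-or-flip false true = inj₂ refl
    same-or-flip false false = inj₁ refl

    Choice : Set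
    Choice = Bool × Bool × Bool

    cells : Choice → List (Cell n)
    cells (a , b , k) =
      (ρ a , κ b) ∷
      (ρ (not a) , columnOf (ρ (not a)) (ς k)) ∷
      (rowOf (κ (not b)) (ς (not k)) , κ (not b)) ∷ []

    completion : Choice → EntrySet n
    completion abk = T ⊕ cells abk

    -- the three cells differ in row, in column and in symbol respectively
    cells-unique : ∀ abk → Unique (cells abk)
    cells-unique (a , b , k) = distinct₃
      (λ e → flip≢ ρ-injective a (sym (cong proj₁ e)))
      (λ e → flip≢ κ-injective b (sym (cong proj₂ e)))
      (λ e → flip≢ ς-injective k (sym (trans (sym (columnOf-spec _ _)) (trans (cong symbol e) (rowOf-spec _ _)))))

    valid : ∀ abk → CoverContaining L T (completion abk)
    valid (a , b , k) = extension-cover (cells (a , b , k)) (cells-unique (a , b , k))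
      (off-row (ρ-missing a) ∷ off-row (ρ-missing (not a)) ∷ off-column (κ-missing (not b)) ∷ [])
      (cong suc (sym d≡2)) meets-rows meets-columns meets-symbols
      where
      meets-rows : Meets (_∈ cells (a , b , k)) proj₁ Rows.missing
      meets-rows i mi with ρ-onto i mi
      ... | x , refl with same-or-flip a x
      ...   | inj₁ refl = _ , here refl , refl
      ...   | inj₂ refl = _ , there (here refl) , refl
      meets-columns : Meets (_∈ cells (a , b , k)) proj₂ Cols.missing
      meets-columns j mj with κ-onto j mj
      ... | x , refl with same-or-flip b x
      ...   | inj₁ refl = _ , here refl , refl
      ...   | inj₂ refl = _ , there (there (here refl)) , refl
      meets-symbols : Meets (_∈ cells (a , b , k)) symbol Syms.missing
      meets-symbols s ms with ς-onto s ms
      ... | x , refl with same-or-flip k x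
      ...   | inj₁ refl = _ , there (here refl) , columnOf-spec _ _
      ...   | inj₂ refl = _ , there (there (here refl)) , rowOf-spec _ _

    -- The first cell determines a and b (the others have a missing symbol
    -- besides a missing row or column), then the second determines k.
    completion-injective : ∀ abk abk′ → completion abk ≡ completion abk′ → abk ≡ abk′
    completion-injective (a , b , k) (a′ , b′ , k′) same
      with added-elsewhere (cells (a , b , k)) (cells (a′ , b′ , k′)) same (here refl) (off-row (ρ-missing a))
    ... | there (here e) = ⊥-elim (free-cell-absurd (ρ a , κ b) (ρ-missing a) (κ-missing b)
          (subst (λ s → Syms.missing s ≡ true) (sym (trans (cong symbol e) (columnOf-spec _ _))) (ς-missing k′)))
    ... | there (there (here e)) = ⊥-elim (free-cell-absurd (ρ a , κ b) (ρ-missing a) (κ-missing b)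
          (subst (λ s → Syms.missing s ≡ true) (sym (trans (cong symbol e) (rowOf-spec _ _))) (ς-missing (not k′))))
    ... | here e with ρ-injective (cong proj₁ e) | κ-injective (cong proj₂ e)
    ...   | refl | refl
      with added-elsewhere (cells (a , b , k)) (cells (a , b , k′)) same (there (here refl))
             (off-row (ρ-missing (not a)))
    ...     | here e′ = ⊥-elim (flip≢ ρ-injective a (cong proj₁ e′))
    ...     | there (here e′) =
      cong (λ k → a , b , k)
        (ς-injective (trans (sym (columnOf-spec _ _)) (trans (cong symbol e′) (columnOf-spec _ _))))
    ...     | there (there (here e′)) = ⊥-elim (free-cell-absurd (ρ (not a) , columnOf (ρ (not a)) (ς k))
          (ρ-missing (not a)) (subst (λ j → Cols.missing j ≡ true) (sym (cong proj₂ e′)) (κ-missing (not b)))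
          (subst (λ s → Syms.missing s ≡ true) (sym (columnOf-spec _ _)) (ς-missing k)))

    choices : List Choice
    choices = cartesianProduct bools (cartesianProduct bools bools)
      where
      bools : List Bool
      bools = true ∷ false ∷ []

    choices-unique : Unique choices
    choices-unique = Unique.cartesianProduct⁺ two (Unique.cartesianProduct⁺ two two)
      where
      two : Unique (true ∷ false ∷ [])
      two = distinct₂ (λ ())

    ∈-choices : ∀ abk → abk ∈ choices
    ∈-choices (a , b , k) = ∈-cartesianProduct⁺ (∈-bools a) (∈-cartesianProduct⁺ (∈-bools b) (∈-bools k))
      where
      ∈-bools : ∀ x → x ∈ true ∷ false ∷ []
      ∈-bools true = here refl
      ∈-bools false = there (here refl)

    module ChoiceOf (C : EntrySet n) (cover : CoverContaining L T C) where
      open Extra C cover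

      u v w : Bool → Cell n
      u x = proj₁ (extra-rows (ρ x) (ρ-missing x))
      v x = proj₁ (extra-columns (κ x) (κ-missing x))
      w x = proj₁ (extra-symbols (ς x) (ς-missing x))

      eu : ∀ x → extra (u x) ≡ true
      eu x = proj₁ (proj₂ (extra-rows (ρ x) (ρ-missing x)))

      ev : ∀ x → extra (v x) ≡ true
      ev x = proj₁ (proj₂ (extra-columns (κ x) (κ-missing x)))

      ew : ∀ x → extra (w x) ≡ true
      ew x = proj₁ (proj₂ (extra-symbols (ς x) (ς-missing x)))

      row-u : ∀ x → proj₁ (u x) ≡ ρ x
      row-u x = proj₂ (proj₂ (extra-rows (ρ x) (ρ-missing x)))

      column-v : ∀ x → proj₂ (v x) ≡ κ x
      column-v x = proj₂ (proj₂ (extra-columns (κ x) (κ-missing x)))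

      symbol-w : ∀ x → symbol (w x) ≡ ς x
      symbol-w x = proj₂ (proj₂ (extra-symbols (ς x) (ς-missing x)))

      no-four-extras : ∀ {p q p′ q′} → extra p ≡ true → extra q ≡ true → extra p′ ≡ true → extra q′ ≡ true →
        p ≢ q → p ≢ p′ → p ≢ q′ → q ≢ p′ → q ≢ q′ → p′ ≢ q′ → ⊥
      no-four-extras ep eq ep′ eq′ ≢₁ ≢₂ ≢₃ ≢₄ ≢₅ ≢₆ = <-irrefl refl (subst (4 ≤_) (cong suc d≡2)
        (extra-bound (distinct₄ ≢₁ ≢₂ ≢₃ ≢₄ ≢₅ ≢₆) (ep ∷ eq ∷ ep′ ∷ eq′ ∷ [])))

      -- Four extra entries meet the two missing rows and the two missing
      -- columns; as there are only three, one of them meets both.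
      corner : Σ Bool λ a → Σ Bool λ b → u a ≡ v b
      corner with u true ≟ᶜ v true | u true ≟ᶜ v false | u false ≟ᶜ v true | u false ≟ᶜ v false
      ... | yes e | _ | _ | _ = true , true , e
      ... | no _ | yes e | _ | _ = true , false , e
      ... | no _ | no _ | yes e | _ = false , true , e
      ... | no _ | no _ | no _ | yes e = false , false , e
      ... | no ≢₂ | no ≢₃ | no ≢₄ | no ≢₅ = ⊥-elim (no-four-extras (eu true) (eu false) (ev true) (ev false)
          (λ e → flip≢ ρ-injective true (trans (sym (row-u false)) (trans (sym (cong proj₁ e)) (row-u true))))
          ≢₂ ≢₃ ≢₄ ≢₅
          (λ e → flip≢ κ-injective true (trans (sym (column-v false)) (trans (sym (cong proj₂ e)) (column-v true)))))

      a b : Bool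
      a = proj₁ corner
      b = proj₁ (proj₂ corner)

      x y z : Cell n
      x = u a
      y = u (not a)
      z = v (not b)

      x-at : x ≡ (ρ a , κ b)
      x-at = cong₂ _,_ (row-u a) (trans (cong proj₂ (proj₂ (proj₂ corner))) (column-v b))

      x≢y : x ≢ y
      x≢y e = flip≢ ρ-injective a (trans (sym (row-u (not a))) (trans (sym (cong proj₁ e)) (row-u a)))

      x≢z : x ≢ z
      x≢z e = flip≢ κ-injective b (trans (sym (column-v (not b))) (trans (sym (cong proj₂ e)) (cong proj₂ x-at)))

      -- The symbol of a cell on a missing row and a missing column is not
      -- missing, so it is not ς k.
      not-symbol-entry : ∀ {p} k → Rows.missing (proj₁ p) ≡ true → Cols.missing (proj₂ p) ≡ true → w k ≢ p
      not-symbol-entry {p} k mr mc refl =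
        free-cell-absurd p mr mc (subst (λ s → Syms.missing s ≡ true) (sym (symbol-w k)) (ς-missing k))

      w≢x : ∀ k → w k ≢ x
      w≢x k = not-symbol-entry k (subst (λ i → Rows.missing i ≡ true) (sym (row-u a)) (ρ-missing a))
        (subst (λ j → Cols.missing j ≡ true) (sym (cong proj₂ x-at)) (κ-missing b))

      w-distinct : w true ≢ w false
      w-distinct e = flip≢ ς-injective true (trans (sym (symbol-w false)) (trans (sym (cong symbol e)) (symbol-w true)))

      -- If y = z were on a missing row and column, the symbol entries
      -- w true, w false would be two further extra entries.
      y≢z : y ≢ z
      y≢z e = no-four-extras (eu a) (eu (not a)) (ew true) (ew false) x≢y (≢-sym (w≢x true)) (≢-sym (w≢x false))
        (≢-sym (w≢y true)) (≢-sym (w≢y false)) w-distinct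
        where
        w≢y : ∀ k → w k ≢ y
        w≢y k = not-symbol-entry k (subst (λ i → Rows.missing i ≡ true) (sym (row-u (not a))) (ρ-missing (not a)))
          (subst (λ j → Cols.missing j ≡ true) (sym (trans (cong proj₂ e) (column-v (not b)))) (κ-missing (not b)))

      xyz : List (Cell n)
      xyz = x ∷ y ∷ z ∷ []

      xyz-unique : Unique xyz
      xyz-unique = distinct₃ x≢y x≢z y≢z

      symbol-entry : ∀ k → w k ≡ y ⊎ w k ≡ z
      symbol-entry k
        with extras-exhaust xyz xyz-unique (eu a ∷ eu (not a) ∷ ev (not b) ∷ []) (cong suc (sym d≡2)) (ew k)
      ... | here e = ⊥-elim (w≢x k e)
      ... | there (here e) = inj₁ e
      ... | there (there (here e)) = inj₂ e

      k : Bool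
      k with symbol-entry true
      ... | inj₁ _ = true
      ... | inj₂ _ = false

      symbols-yz : symbol y ≡ ς k × symbol z ≡ ς (not k)
      symbols-yz with symbol-entry true | symbol-entry false
      ... | inj₁ e | inj₂ e′ =
        trans (cong symbol (sym e)) (symbol-w true) , trans (cong symbol (sym e′)) (symbol-w false)
      ... | inj₂ e | inj₁ e′ =
        trans (cong symbol (sym e′)) (symbol-w false) , trans (cong symbol (sym e)) (symbol-w true)
      ... | inj₁ e | inj₁ e′ = ⊥-elim (w-distinct (trans e (sym e′)))
      ... | inj₂ e | inj₂ e′ = ⊥-elim (w-distinct (trans e (sym e′)))

      y-at : y ≡ (ρ (not a) , columnOf (ρ (not a)) (ς k))
      y-at = cong₂ _,_ (row-u (not a)) (row-injective (ρ (not a))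
        (trans (subst (λ i → L i (proj₂ y) ≡ ς k) (row-u (not a)) (proj₁ symbols-yz)) (sym (columnOf-spec _ _))))

      z-at : z ≡ (rowOf (κ (not b)) (ς (not k)) , κ (not b))
      z-at = cong₂ _,_ (column-injective (κ (not b))
        (trans (subst (λ j → L (proj₁ z) j ≡ ς (not k)) (column-v (not b)) (proj₂ symbols-yz)) (sym (rowOf-spec _ _))))
        (column-v (not b))

      C≡completion : C ≡ completion (a , b , k)
      C≡completion = Cv≡T⊕ (cells (a , b , k)) (cells-unique (a , b , k))
        (subst (λ p → extra p ≡ true) x-at (eu a) ∷ subst (λ p → extra p ≡ true) y-at (eu (not a)) ∷
         subst (λ p → extra p ≡ true) z-at (ev (not b)) ∷ [])
        (cong suc (sym d≡2))

  the-two : ∀ M → Fins.# M ≡ 2 → TheTwo M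
  the-two M two with Fins.#≡2 M two
  ... | p , q , p≢q , Mp , Mq , one-of = label , labelled , injective , onto
    where
    label : Bool → Fin n
    label true = p
    label false = q
    labelled : ∀ x → M (label x) ≡ true
    labelled true = Mp
    labelled false = Mq
    injective : ∀ {x y} → label x ≡ label y → x ≡ y
    injective {true} {true} _ = refl
    injective {true} {false} e = ⊥-elim (p≢q e)
    injective {false} {true} e = ⊥-elim (p≢q (sym e))
    injective {false} {false} _ = refl
    onto : ∀ k → M k ≡ true → Σ Bool λ x → k ≡ label x
    onto k Mk with one-of k Mk
    ... | inj₁ e = true , e
    ... | inj₂ e = false , e

  deficit-0 : d ≡ 0 → ExactlyMany (n * n ∸ n) (CoverContaining L T) ×
    (∀ C → CoverContaining L T C → ¬ IsMinimalCover L C)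
  deficit-0 d≡0 =
    subst (λ m → ExactlyMany m (CoverContaining L T)) #outside
      (counted-by plus outside (Cells.enumerate-unique (not ∘ t)) plus-injective valid complete) ,
    not-minimal
    where open Deficit0 d≡0

  deficit-1 : d ≡ 1 → ExactlyMany (3 * (n ∸ 1)) (CoverContaining L T) ×
    (∀ C → CoverContaining L T C → IsMinimalCover L C)
  deficit-1 d≡1 =
    subst (λ m → ExactlyMany m (CoverContaining L T)) #shapes
      (counted-by completion shapes shapes-unique
        (λ {σ} {τ} σ∈ τ∈ → completion-injective σ τ (∈-shapes⁻ σ∈) (∈-shapes⁻ τ∈))
        (λ {σ} σ∈ → valid σ (∈-shapes⁻ σ∈)) complete) ,
    minimal
    where
    open Deficit1 d≡1 (Fins.#≡1 Rows.missing (trans #missing-rows d≡1))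
      (Fins.#≡1 Cols.missing (trans #missing-columns d≡1)) (Fins.#≡1 Syms.missing (trans #missing-symbols d≡1))

  deficit-2 : d ≡ 2 → ExactlyMany 8 (CoverContaining L T)
  deficit-2 d≡2 =
    counted-by completion choices choices-unique (λ {abk} {abk′} _ _ → completion-injective abk abk′)
      (λ {abk} _ → valid abk) (λ C cover → _ , ∈-choices _ , ChoiceOf.C≡completion C cover)
    where
    open Deficit2 d≡2 (the-two Rows.missing (trans #missing-rows d≡2))
      (the-two Cols.missing (trans #missing-columns d≡2)) (the-two Syms.missing (trans #missing-symbols d≡2))

  deficit≥3 : 3 ≤ d → ∀ C → ¬ CoverContaining L T C
  deficit≥3 3≤d C cover with ≤-trans 3≤d (Extra.d≤2 C cover)
  ... | s≤s (s≤s ())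

theorem2p6 : (n : ℕ) → 3 ≤ n → (L : Square n) → IsLatin L →
    (d : ℕ) → (T : EntrySet n) → MaximalPartialTransversal L d T →
    (d ≡ 0 → ExactlyMany (n * n ∸ n) (CoverContaining L T) ×
      (∀ C → CoverContaining L T C → ¬ IsMinimalCover L C)) ×
    (d ≡ 1 → ExactlyMany (3 * (n ∸ 1)) (CoverContaining L T) ×
      (∀ C → CoverContaining L T C → IsMinimalCover L C)) ×
    (d ≡ 2 → ExactlyMany 8 (CoverContaining L T)) ×
    (3 ≤ d → ∀ C → ¬ CoverContaining L T C)
theorem2p6 n _ L latin d T maximal = deficit-0 , deficit-1 , deficit-2 , deficit≥3
  where open Transversal L latin d T maximal
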